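{- Let $n\ge 0$ and $k\ge 1$ be integers and let $t_1,\ldots,t_k$ be nonnegative integers. Then \[\left[{n\atop t_1,t_2,\ldots,t_k}\right]=\sum_{\ell_1+\cdots+\ell_k=n}\binom{n}{\ell_1,\ell_2,\ldots,\ell_k}\left[{\ell_1\atop t_1}\right]\left[{\ell_2\atop t_2}\right]\cdots\left[{\ell_k\atop t_k}\right],\] where the sum runs over all $k$-tuples of nonnegative integers $(\ell_1,\ldots,\ell_k)$ with $\ell_1+\cdots+\ell_k=n$ and $\binom{n}{\ell_1,\ldots,\ell_k}=\frac{n!}{\ell_1!\cdots\ell_k!}$ is the multinomial coefficient.
   Context: $\left[{n\atop m}\right]$ denotes the (signless) Stirling number of the first kind: the number of permutations of $[n]=\{1,\ldots,n\}$ with exactly $m$ cycles (so $\left[{0\atop 0}\right]=1$). A $(t_1,\ldots,t_k)$-coloured permutation of $[n]$ is a permutation of $[n]$ together with an assignment of a colour from $\{1,\ldots,k\}$ to each of its cycles such that exactly $t_i$ cycles receive colour $i$, for each $i$. The number of $(t_1,\ldots,t_k)$-coloured permutations of $[n]$ is denoted $\left[{n\atop t_1,\ldots,t_k}\right]$. -}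

module Defs where

open import Data.Nat using (ℕ; zero; suc; _+_; _*_; _∸_; _≤ᵇ_; _≡ᵇ_; NonZero; _!; _/_)
open import Data.Nat.Properties using (_!≢0; m*n≢0)
open import Data.Bool using (Bool; true; false; _∧_; if_then_else_)
open import Data.Fin using (Fin; toℕ; _≟_)
open import Data.List using (List; []; _∷_; [_]; map; concatMap; allFin; length; filterᵇ)
open import Data.Vec using (Vec; []; _∷_; lookup; foldr)
open import Relation.Nullary.Decidable using (⌊_⌋)
import Data.Nat.ListAction
open import Data.Product using (_×_; _,_; uncurry)

allᶠ : ∀ {n} → (Fin n → Bool) → Bool
allᶠ {n} p = Data.List.foldr (λ i b → p i ∧ b) true (allFin n)

countᵇ : ∀ {A : Set} → (A → Bool) → List A → ℕ
countᵇ p xs = length (filterᵇ p xs)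

allVecs : (m n : ℕ) → List (Vec (Fin m) n)
allVecs m zero = [ [] ]
allVecs m (suc n) = concatMap (λ x → map (x ∷_) (allVecs m n)) (allFin m)

-- A map [n] → [n], given as its table of values, is a permutation iff it is
-- injective (for a finite set injective ⇔ bijective).
isPerm : ∀ {n} → Vec (Fin n) n → Bool
isPerm v = allᶠ (λ i → allᶠ (λ j →
  if ⌊ lookup v i ≟ lookup v j ⌋ then ⌊ i ≟ j ⌋ else true))

iter : ∀ {n} → Vec (Fin n) n → ℕ → Fin n → Fin n
iter v zero i = i
iter v (suc r) i = lookup v (iter v r i)

-- i is the least element of its cycle under v.  The cycle of i is
-- {v^r(i) | r < n} since every cycle has length ≤ n.
isCycleMin : ∀ {n} → Vec (Fin n) n → Fin n → Bool
isCycleMin {n} v i = allᶠ {n} (λ r → toℕ i ≤ᵇ toℕ (iter v (toℕ r) i))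

-- Number of cycles of v (each cycle is counted once, via its least element).
numCycles : ∀ {n} → Vec (Fin n) n → ℕ
numCycles {n} v = countᵇ (isCycleMin v) (allFin n)

stirling1 : ℕ → ℕ → ℕ
stirling1 n m = countᵇ (λ v → isPerm v ∧ (numCycles v ≡ᵇ m)) (allVecs n n)

-- A (t₁,…,t_k)-coloured permutation of [n] is encoded as a pair (v , c) where
-- v is a permutation of [n] and c : [n] → [k] is constant on the cycles of v
-- (so c is exactly a colouring of the cycles of v), such that exactly t_j
-- cycles receive colour j.
isColouredPerm : ∀ {n k} → Vec ℕ k → Vec (Fin n) n → Vec (Fin k) n → Bool
isColouredPerm {n} {k} t v c =
  isPerm v
  ∧ allᶠ (λ i → ⌊ lookup c (lookup v i) ≟ lookup c i ⌋)
  ∧ allᶠ (λ j →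
       countᵇ (λ i → isCycleMin v i ∧ ⌊ lookup c i ≟ j ⌋) (allFin n)
         ≡ᵇ lookup t j)

allPairs : (n k : ℕ) → List (Vec (Fin n) n × Vec (Fin k) n)
allPairs n k = concatMap (λ v → map (v ,_) (allVecs k n)) (allVecs n n)

colouredStirling : (n : ℕ) → ∀ {k} → Vec ℕ k → ℕ
colouredStirling n {k} t = countᵇ (uncurry (isColouredPerm t)) (allPairs n k)

prodFact : ∀ {k} → Vec ℕ k → ℕ
prodFact [] = 1
prodFact (l ∷ ls) = l ! * prodFact ls

prodFact≢0 : ∀ {k} (ls : Vec ℕ k) → NonZero (prodFact ls)
prodFact≢0 [] = _
prodFact≢0 (l ∷ ls) = m*n≢0 (l !) (prodFact ls) {{l !≢0}} {{prodFact≢0 ls}}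

multinomial : ∀ {k} → ℕ → Vec ℕ k → ℕ
multinomial n ls = (n ! / prodFact ls) {{prodFact≢0 ls}}

vsum : ∀ {k} → Vec ℕ k → ℕ
vsum = foldr _ _+_ 0

-- All k-tuples (ℓ₁,…,ℓ_k) of nonnegative integers with ℓ₁+⋯+ℓ_k = n
-- (each ℓ_i ≤ n, so they are enumerated among vectors over Fin (suc n)).
compositions : (k n : ℕ) → List (Vec ℕ k)
compositions k n =
  map (Data.Vec.map toℕ) (filterᵇ (λ v → vsum (Data.Vec.map toℕ v) ≡ᵇ n) (allVecs (suc n) k))

rhs : ∀ {k} → ℕ → Vec ℕ k → ℕ
rhs {k} n t = Data.Nat.ListAction.sum (map term (compositions k n))
  where
  term : Vec ℕ k → ℕ
  term ls = multinomial n ls * foldr _ _*_ 1 (Data.Vec.zipWith stirling1 ls t)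

-- Both sides are shown to equal R t n, where R is defined by recursion on the colour vector:
-- R (t₁ ∷ t) = [· ; t₁] ⋆ R t with ⋆ the binomial convolution (f ⋆ g)(n) = Σ_i C(n,i) f(i) g(n−i).
--
-- Left side: inserting the element n+1 into a coloured permutation of [n], either after some
-- element of a cycle or as a new singleton cycle of colour j, is a bijection; this yields
-- the recurrence  [n+1 ; t] = n [n ; t] + Σ_j [t_j ≠ 0] [n ; t − e_j]  with the obvious
-- initial values.  Its one-colour case is the Stirling recurrence, and the Leibniz rule for ⋆
-- shows that R obeys the same recurrence, so the left side is R by induction on n.
-- Right side: writing the multinomial coefficient as a product of binomial coefficients
-- C(ℓ₁+⋯+ℓ_k, ℓ₁) C(ℓ₂+⋯+ℓ_k, ℓ₂) ⋯ and summing out ℓ₁ first unfolds the sum over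
-- compositions into the iterated convolution R.

module Submission where

open import Defs
open import Data.Nat using (ℕ; _≤_)
open import Data.Vec using (Vec)
open import Relation.Binary.PropositionalEquality using (_≡_)

open import Data.Nat using (zero; suc; _+_; _*_; _∸_; _<_; _≤ᵇ_; _≡ᵇ_; z≤n; s≤s; _!; _/_)
open import Data.Nat.Properties
open import Data.Nat.DivMod using (m*n/n≡m; m/n*n≡m)
open import Data.Nat.Combinatorics using (_C_; nCk+nC[k+1]≡[n+1]C[k+1]; k>n⇒nCk≡0; nCk≡n!/k![n-k]!; k![n∸k]!∣n!)
open import Data.Nat.ListAction using (sum)
open import Data.Nat.Tactic.RingSolver using (solve-∀)
open import Data.Bool using (Bool; true; false; T; _∧_; not; if_then_else_)
open import Data.Bool.Properties using (T-≡; ∧-identityʳ)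
open import Data.Fin using (Fin; zero; suc; toℕ; inject₁; fromℕ; fromℕ<; punchOut) renaming (_≟_ to _≟ᶠ_)
import Data.Fin.Properties as FinP
open import Data.Fin.Relation.Unary.Top using (view; ‵fromℕ; ‵inject₁)
open import Data.Vec using (lookup; tabulate; []; _∷_)
import Data.Vec.Properties as VecP
open import Data.List using (List; []; _∷_; map; filterᵇ; length; _++_; allFin; concatMap; cartesianProductWith; cartesianProduct)
import Data.List.Properties as ListP
import Data.List.Relation.Unary.All as All
import Data.List.Relation.Unary.AllPairs as AllPairs
open import Data.List.Relation.Unary.Any using (here)
open import Data.List.Membership.Propositional using (_∈_)
open import Data.List.Membership.Propositional.Properties using (∈-map⁺; ∈-map⁻; ∈-filter⁺; ∈-filter⁻; ∈-allFin; ∈-cartesianProductWith⁺; ∈-++⁺ˡ; ∈-++⁺ʳ)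
open import Data.List.Membership.Propositional.Properties.WithK using (unique∧set⇒bag)
open import Data.List.Relation.Unary.Unique.Propositional using (Unique)
import Data.List.Relation.Unary.Unique.Propositional.Properties as UniqueP
open import Data.List.Relation.Binary.BagAndSetEquality using (∼bag⇒↭)
open import Data.List.Relation.Binary.Permutation.Propositional.Properties using (↭-length)
open import Data.Product using (_×_; _,_; proj₁; proj₂; ∃; Σ; uncurry; map₂)
open import Data.Sum using (_⊎_; inj₁; inj₂)
open import Data.Sum.Properties using (inj₁-injective; inj₂-injective)
open import Data.Empty using (⊥; ⊥-elim)
open import Function using (_∘_; id)
open import Function.Definitions using (Injective)
open import Function.Bundles using (mk⇔; Equivalence)
open import Relation.Binary.PropositionalEquality using (_≢_; refl; sym; trans; cong; cong₂; subst; subst₂; module ≡-Reasoning)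
open import Relation.Nullary using (¬_; yes; no; Dec)
open import Relation.Nullary.Decidable using (⌊_⌋)

open ≡-Reasoning

-- Boolean tests and the propositions they decide.  Everything in Defs is a boolean
-- program, so each combinatorial fact is transported through these reflection lemmas.

toT : ∀ {b} → b ≡ true → T b
toT = Equivalence.from T-≡

fromT : ∀ {b} → T b → b ≡ true
fromT = Equivalence.to T-≡

∧-true : ∀ {a b} → a ∧ b ≡ true → a ≡ true × b ≡ true
∧-true {true} {true} _ = refl , refl

∧-intro : ∀ {a b} → a ≡ true → b ≡ true → a ∧ b ≡ true
∧-intro refl refl = refl

boolExt : ∀ {a b} → (a ≡ true → b ≡ true) → (b ≡ true → a ≡ true) → a ≡ b
boolExt {false} {false} _ _ = refl
boolExt {false} {true} _ g = g refl
boolExt {true} {false} f _ = sym (f refl)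
boolExt {true} {true} _ _ = refl

≟-true : ∀ {n} {i j : Fin n} → ⌊ i ≟ᶠ j ⌋ ≡ true → i ≡ j
≟-true {i = i} {j} e with i ≟ᶠ j
... | yes p = p
≟-true () | no _

≟-refl : ∀ {n} (i : Fin n) → ⌊ i ≟ᶠ i ⌋ ≡ true
≟-refl i with i ≟ᶠ i
... | yes _ = refl
... | no ¬p = ⊥-elim (¬p refl)

≟-false : ∀ {n} {i j : Fin n} → i ≢ j → ⌊ i ≟ᶠ j ⌋ ≡ false
≟-false {i = i} {j} ne with i ≟ᶠ j
... | yes p = ⊥-elim (ne p)
... | no _ = refl

≡ᵇ-true : ∀ {m n} → (m ≡ᵇ n) ≡ true → m ≡ n
≡ᵇ-true {m} {n} e = ≡ᵇ⇒≡ m n (toT e)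

≡ᵇ-intro : ∀ {m n} → m ≡ n → (m ≡ᵇ n) ≡ true
≡ᵇ-intro {m} {n} e = fromT (≡⇒≡ᵇ m n e)

allTab⇒ : ∀ {A : Set} {n} (f : Fin n → A) (p : A → Bool) →
  Data.List.foldr (λ i b → p i ∧ b) true (Data.List.tabulate f) ≡ true → ∀ i → p (f i) ≡ true
allTab⇒ {n = suc n} f p e zero = proj₁ (∧-true e)
allTab⇒ {n = suc n} f p e (suc i) = allTab⇒ (f ∘ suc) p (proj₂ (∧-true e)) i

allTab⇐ : ∀ {A : Set} {n} (f : Fin n → A) (p : A → Bool) →
  (∀ i → p (f i) ≡ true) → Data.List.foldr (λ i b → p i ∧ b) true (Data.List.tabulate f) ≡ true
allTab⇐ {n = zero} f p h = refl
allTab⇐ {n = suc n} f p h = ∧-intro (h zero) (allTab⇐ (f ∘ suc) p (h ∘ suc))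

allᶠ⇒ : ∀ {n} (p : Fin n → Bool) → allᶠ p ≡ true → ∀ i → p i ≡ true
allᶠ⇒ p = allTab⇒ id p

allᶠ⇐ : ∀ {n} (p : Fin n → Bool) → (∀ i → p i ≡ true) → allᶠ p ≡ true
allᶠ⇐ p = allTab⇐ id p

allᶠ-cong : ∀ {n} {p q : Fin n → Bool} → (∀ i → p i ≡ q i) → allᶠ p ≡ allᶠ q
allᶠ-cong {p = p} {q} e = boolExt (λ h → allᶠ⇐ q (λ i → trans (sym (e i)) (allᶠ⇒ p h i)))
                                   (λ h → allᶠ⇐ p (λ i → trans (e i) (allᶠ⇒ q h i)))

ind : Bool → ℕ
ind true = 1
ind false = 0

ind-∧ : ∀ a b → ind (a ∧ b) ≡ ind a * ind b
ind-∧ false b = refl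
ind-∧ true b = sym (+-identityʳ _)

Σl : ∀ {A : Set} → (A → ℕ) → List A → ℕ
Σl h xs = sum (map h xs)

countΣ : ∀ {A : Set} (p : A → Bool) xs → countᵇ p xs ≡ Σl (ind ∘ p) xs
countΣ p [] = refl
countΣ p (x ∷ xs) with p x
... | true = cong suc (countΣ p xs)
... | false = countΣ p xs

Σl-++ : ∀ {A : Set} (h : A → ℕ) xs ys → Σl h (xs ++ ys) ≡ Σl h xs + Σl h ys
Σl-++ h [] ys = refl
Σl-++ h (x ∷ xs) ys = trans (cong (h x +_) (Σl-++ h xs ys)) (sym (+-assoc (h x) _ _))

Σl-map : ∀ {A B : Set} (h : B → ℕ) (f : A → B) xs → Σl h (map f xs) ≡ Σl (h ∘ f) xs
Σl-map h f xs = cong sum (sym (ListP.map-∘ xs))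

Σl-cong : ∀ {A : Set} {h h' : A → ℕ} → (∀ x → h x ≡ h' x) → ∀ xs → Σl h xs ≡ Σl h' xs
Σl-cong e xs = cong sum (ListP.map-cong e xs)

Σl-+ : ∀ {A : Set} (h h' : A → ℕ) xs → Σl (λ x → h x + h' x) xs ≡ Σl h xs + Σl h' xs
Σl-+ h h' [] = refl
Σl-+ h h' (x ∷ xs) rewrite Σl-+ h h' xs = +-interchange (h x) (h' x) (Σl h xs) (Σl h' xs)
  where
  +-interchange : ∀ a b c d → a + b + (c + d) ≡ a + c + (b + d)
  +-interchange = solve-∀

Σl-* : ∀ {A : Set} (c : ℕ) (h : A → ℕ) xs → Σl (λ x → c * h x) xs ≡ c * Σl h xs
Σl-* c h [] = sym (*-zeroʳ c)
Σl-* c h (x ∷ xs) = trans (cong (c * h x +_) (Σl-* c h xs)) (sym (*-distribˡ-+ c (h x) _))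

Σl-const : ∀ {A : Set} (c : ℕ) xs → Σl {A} (λ _ → c) xs ≡ length xs * c
Σl-const c [] = refl
Σl-const c (x ∷ xs) = cong (c +_) (Σl-const c xs)

Σl-swap : ∀ {A B : Set} (h : A → B → ℕ) xs ys →
  Σl (λ x → Σl (h x) ys) xs ≡ Σl (λ y → Σl (λ x → h x y) xs) ys
Σl-swap h [] ys = sym (trans (Σl-const 0 ys) (*-zeroʳ (length ys)))
Σl-swap h (x ∷ xs) ys =
  trans (cong (Σl (h x) ys +_) (Σl-swap h xs ys)) (sym (Σl-+ (h x) (λ y → Σl (λ x' → h x' y) xs) ys))

Σl-filter : ∀ {A : Set} (h : A → ℕ) (p : A → Bool) xs → Σl h (filterᵇ p xs) ≡ Σl (λ x → ind (p x) * h x) xs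
Σl-filter h p [] = refl
Σl-filter h p (x ∷ xs) with p x
... | true = cong₂ _+_ (sym (+-identityʳ (h x))) (Σl-filter h p xs)
... | false = Σl-filter h p xs

countᵇ-cong : ∀ {A : Set} {p q : A → Bool} → (∀ x → p x ≡ q x) → ∀ xs → countᵇ p xs ≡ countᵇ q xs
countᵇ-cong {p = p} {q} e xs = trans (countΣ p xs) (trans (Σl-cong (λ x → cong ind (e x)) xs) (sym (countΣ q xs)))

Σl-cartesian : ∀ {A B C : Set} (w : C → ℕ) (h : A → B → C) xs ys →
  Σl w (cartesianProductWith h xs ys) ≡ Σl (λ x → Σl (w ∘ h x) ys) xs
Σl-cartesian w h [] ys = refl
Σl-cartesian w h (x ∷ xs) ys =
  trans (Σl-++ w (map (h x) ys) _) (cong₂ _+_ (Σl-map w (h x) ys) (Σl-cartesian w h xs ys))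

Σl-tabulate : ∀ {A : Set} {n} (h : A → ℕ) (f : Fin n → A) → Σl h (Data.List.tabulate f) ≡ Σl (h ∘ f) (allFin n)
Σl-tabulate {n = zero} h f = refl
Σl-tabulate {n = suc n} h f =
  cong (h (f zero) +_) (trans (Σl-tabulate h (f ∘ suc)) (sym (Σl-tabulate (h ∘ f) suc)))

Σl-first : ∀ {n} (h : Fin (suc n) → ℕ) → Σl h (allFin (suc n)) ≡ h zero + Σl (h ∘ suc) (allFin n)
Σl-first h = cong (h zero +_) (Σl-tabulate h suc)

Σl-last : ∀ {n} (h : Fin (suc n) → ℕ) → Σl h (allFin (suc n)) ≡ Σl (h ∘ inject₁) (allFin n) + h (fromℕ n)
Σl-last {zero} h = +-identityʳ (h zero)
Σl-last {suc n} h = begin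
    Σl h (allFin (suc (suc n)))
  ≡⟨ Σl-first h ⟩
    h zero + Σl (h ∘ suc) (allFin (suc n))
  ≡⟨ cong (h zero +_) (Σl-last (h ∘ suc)) ⟩
    h zero + (Σl (h ∘ suc ∘ inject₁) (allFin n) + h (fromℕ (suc n)))
  ≡⟨ sym (+-assoc (h zero) _ _) ⟩
    h zero + Σl (h ∘ suc ∘ inject₁) (allFin n) + h (fromℕ (suc n))
  ≡⟨ cong (_+ h (fromℕ (suc n))) (sym (Σl-first (h ∘ inject₁))) ⟩
    Σl (h ∘ inject₁) (allFin (suc n)) + h (fromℕ (suc n))
  ∎

-- Counting principle: if f, with partial inverse g, matches the elements of xs passing P
-- with the elements of ys passing Q, the counts agree (xs, ys complete and duplicate-free).
-- f need not be injective outside P, so we count the images under the injective tagging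
-- a ↦ inj₁ (f a) if P a, inj₂ a otherwise, and compare bags.
module _ {A B : Set} (xs : List A) (ys : List B) (uniqueXs : Unique xs) (uniqueYs : Unique ys)
  (allXs : ∀ a → a ∈ xs) (allYs : ∀ b → b ∈ ys) (P : A → Bool) (Q : B → Bool)
  (f : A → B) (g : B → A) (P≡Q∘f : ∀ a → P a ≡ Q (f a))
  (gf : ∀ a → P a ≡ true → g (f a) ≡ a) (fg : ∀ b → Q b ≡ true → f (g b) ≡ b) where

  private
    tagBy : A → Bool → B ⊎ A
    tagBy a true = inj₁ (f a)
    tagBy a false = inj₂ a

    tag : A → B ⊎ A
    tag a = tagBy a (P a)

    tag-inj : ∀ {a a'} → tag a ≡ tag a' → a ≡ a'
    tag-inj {a} {a'} e with P a in ea | P a' in ea'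
    ... | true | true = trans (sym (gf a ea)) (trans (cong g (inj₁-injective e)) (gf a' ea'))
    ... | false | false = inj₂-injective e

    tag-good : ∀ a → P a ≡ true → tag a ≡ inj₁ (f a)
    tag-good a e rewrite e = refl

    tagged : List (B ⊎ A)
    tagged = map tag (filterᵇ P xs)

    targets : List (B ⊎ A)
    targets = map inj₁ (filterᵇ Q ys)

    tagged⊆targets : ∀ {z} → z ∈ tagged → z ∈ targets
    tagged⊆targets m with ∈-map⁻ _ m
    ... | a , am , refl with ∈-filter⁻ _ {xs = xs} am
    ... | _ , pa = subst (_∈ targets) (sym (tag-good a (fromT pa)))
                     (∈-map⁺ inj₁ (∈-filter⁺ _ (allYs (f a)) (toT (trans (sym (P≡Q∘f a)) (fromT pa)))))

    targets⊆tagged : ∀ {z} → z ∈ targets → z ∈ tagged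
    targets⊆tagged m with ∈-map⁻ _ m
    ... | b , bm , refl with ∈-filter⁻ _ {xs = ys} bm
    ... | _ , qb = subst (_∈ tagged) (trans (tag-good (g b) pgb) (cong inj₁ (fg b (fromT qb))))
                     (∈-map⁺ tag (∈-filter⁺ _ (allXs (g b)) (toT pgb)))
      where
      pgb : P (g b) ≡ true
      pgb = trans (P≡Q∘f (g b)) (trans (cong Q (fg b (fromT qb))) (fromT qb))

  count-bijection : countᵇ P xs ≡ countᵇ Q ys
  count-bijection = begin
      length (filterᵇ P xs)
    ≡⟨ sym (ListP.length-map tag (filterᵇ P xs)) ⟩
      length tagged
    ≡⟨ ↭-length (∼bag⇒↭ (unique∧set⇒bag uniqueTagged uniqueTargets (mk⇔ tagged⊆targets targets⊆tagged))) ⟩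
      length targets
    ≡⟨ ListP.length-map inj₁ (filterᵇ Q ys) ⟩
      length (filterᵇ Q ys)
    ∎
    where
    uniqueTagged : Unique tagged
    uniqueTagged = UniqueP.map⁺ tag-inj (UniqueP.filter⁺ _ uniqueXs)
    uniqueTargets : Unique targets
    uniqueTargets = UniqueP.map⁺ inj₁-injective (UniqueP.filter⁺ _ uniqueYs)

concatMap-cartesian : ∀ {A B C : Set} (h : A → B → C) xs ys →
  concatMap (λ x → map (h x) ys) xs ≡ cartesianProductWith h xs ys
concatMap-cartesian h [] ys = refl
concatMap-cartesian h (x ∷ xs) ys = cong (map (h x) ys ++_) (concatMap-cartesian h xs ys)

allVecs-suc : ∀ m n → allVecs m (suc n) ≡ cartesianProductWith _∷_ (allFin m) (allVecs m n)
allVecs-suc m n = concatMap-cartesian _∷_ (allFin m) (allVecs m n)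

allVecs-unique : ∀ m n → Unique (allVecs m n)
allVecs-unique m zero = All.[] AllPairs.∷ AllPairs.[]
allVecs-unique m (suc n) = subst Unique (sym (allVecs-suc m n))
  (UniqueP.cartesianProductWith⁺ _∷_ VecP.∷-injective (UniqueP.allFin⁺ m) (allVecs-unique m n))

allVecs-complete : ∀ m n (v : Vec (Fin m) n) → v ∈ allVecs m n
allVecs-complete m zero [] = here refl
allVecs-complete m (suc n) (x ∷ v) = subst ((x ∷ v) ∈_) (sym (allVecs-suc m n))
  (∈-cartesianProductWith⁺ _∷_ (∈-allFin x) (allVecs-complete m n v))

allPairs-cartesian : ∀ n k → allPairs n k ≡ cartesianProduct (allVecs n n) (allVecs k n)
allPairs-cartesian n k = concatMap-cartesian _,_ (allVecs n n) (allVecs k n)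

allPairs-unique : ∀ n k → Unique (allPairs n k)
allPairs-unique n k = subst Unique (sym (allPairs-cartesian n k))
  (UniqueP.cartesianProduct⁺ (allVecs-unique n n) (allVecs-unique k n))

allPairs-complete : ∀ n k b → b ∈ allPairs n k
allPairs-complete n k (v , c) = subst ((v , c) ∈_) (sym (allPairs-cartesian n k))
  (∈-cartesianProductWith⁺ _,_ (allVecs-complete n n v) (allVecs-complete k n c))

top : ∀ {n} → Fin (suc n)
top {n} = fromℕ n

top≢inject₁ : ∀ {n} {y : Fin n} → top ≢ inject₁ y
top≢inject₁ = FinP.fromℕ≢inject₁

inject₁<top : ∀ {n} (y : Fin n) → toℕ (inject₁ y) < toℕ (top {n})
inject₁<top {n} y = subst₂ _<_ (sym (FinP.toℕ-inject₁ y)) (sym (FinP.toℕ-fromℕ n)) (FinP.toℕ<n y)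

extendTop : ∀ {A : Set} {n} → (Fin n → A) → A → Fin (suc n) → A
extendTop {n = zero} f a _ = a
extendTop {n = suc n} f a zero = f zero
extendTop {n = suc n} f a (suc x) = extendTop (f ∘ suc) a x

extendTop-inject₁ : ∀ {A : Set} {n} (f : Fin n → A) a y → extendTop f a (inject₁ y) ≡ f y
extendTop-inject₁ {n = suc n} f a zero = refl
extendTop-inject₁ {n = suc n} f a (suc y) = extendTop-inject₁ (f ∘ suc) a y

extendTop-top : ∀ {A : Set} {n} (f : Fin n → A) a → extendTop f a top ≡ a
extendTop-top {n = zero} f a = refl
extendTop-top {n = suc n} f a = extendTop-top (f ∘ suc) a

lowerOr : ∀ {n} → Fin n → Fin (suc n) → Fin n
lowerOr d = extendTop id d

lowerOr-inject₁ : ∀ {n} (d y : Fin n) → lowerOr d (inject₁ y) ≡ y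
lowerOr-inject₁ d y = extendTop-inject₁ id d y

inject₁-lowerOr : ∀ {n} (d : Fin n) (x : Fin (suc n)) → x ≢ top → inject₁ (lowerOr d x) ≡ x
inject₁-lowerOr d x x≢top with view x
... | ‵fromℕ = ⊥-elim (x≢top refl)
... | ‵inject₁ y = cong inject₁ (lowerOr-inject₁ d y)

iterate : ∀ {m} → (Fin m → Fin m) → ℕ → Fin m → Fin m
iterate F zero x = x
iterate F (suc r) x = F (iterate F r x)

iterate-+ : ∀ {m} (F : Fin m → Fin m) a b x → iterate F (a + b) x ≡ iterate F a (iterate F b x)
iterate-+ F zero b x = refl
iterate-+ F (suc a) b x = cong F (iterate-+ F a b x)

iter≡iterate : ∀ {m} (v : Vec (Fin m) m) r x → iter v r x ≡ iterate (lookup v) r x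
iter≡iterate v zero x = refl
iter≡iterate v (suc r) x = cong (lookup v) (iter≡iterate v r x)

-- Every iterate F^r x already occurs among F^0 x, …, F^(m-1) x: by pigeonhole two of
-- F^0 x, …, F^m x coincide, say F^a x = F^b x with a < b ≤ m, and then F^r x = F^(r-(b-a)) x
-- for r ≥ m.
iterate-bounded : ∀ {m} (F : Fin m → Fin m) (x : Fin m) (r : ℕ) →
  Σ ℕ λ r' → r' < m × iterate F r x ≡ iterate F r' x
iterate-bounded {m} F x r with FinP.pigeonhole (n<1+n m) (λ (i : Fin (suc m)) → iterate F (toℕ i) x)
... | i , j , i<j , Fⁱx≡Fʲx = reduce (suc r) r (n<1+n r)
  where
  a b : ℕ
  a = toℕ i
  b = toℕ j
  b≤m : b ≤ m
  b≤m = ≤-pred (FinP.toℕ<n j)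
  reduce : ∀ fuel r → r < fuel → Σ ℕ λ r' → r' < m × iterate F r x ≡ iterate F r' x
  reduce (suc fuel) r (s≤s r≤fuel) with r <? m
  ... | yes r<m = r , r<m , refl
  ... | no r≮m = map₂ (map₂ (trans shorten)) (reduce fuel (d + a) (≤-trans d+a<r r≤fuel))
    where
    d : ℕ
    d = r ∸ b
    r≡d+b : r ≡ d + b
    r≡d+b = sym (m∸n+n≡m (≤-trans b≤m (≮⇒≥ r≮m)))
    d+a<r : d + a < r
    d+a<r = subst (d + a <_) (sym r≡d+b) (+-monoʳ-< d i<j)
    shorten : iterate F r x ≡ iterate F (d + a) x
    shorten = begin
        iterate F r x                     ≡⟨ cong (λ s → iterate F s x) r≡d+b ⟩
        iterate F (d + b) x               ≡⟨ iterate-+ F d b x ⟩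
        iterate F d (iterate F b x)       ≡⟨ cong (iterate F d) (sym Fⁱx≡Fʲx) ⟩
        iterate F d (iterate F a x)       ≡⟨ sym (iterate-+ F d a x) ⟩
        iterate F (d + a) x               ∎

IsCycleMin : ∀ {m} → (Fin m → Fin m) → Fin m → Set
IsCycleMin F x = ∀ r → toℕ x ≤ toℕ (iterate F r x)

isCycleMin⇒ : ∀ {m} (v : Vec (Fin m) m) x → isCycleMin v x ≡ true → IsCycleMin (lookup v) x
isCycleMin⇒ {m} v x e r with iterate-bounded (lookup v) x r
... | r' , r'<m , Fʳx≡Fʳ'x = subst (λ z → toℕ x ≤ toℕ z) (sym Fʳx≡Fʳ'x)
   (subst (λ z → toℕ x ≤ toℕ z) (iter≡iterate v r' x)
     (subst (λ s → toℕ x ≤ toℕ (iter v s x)) (FinP.toℕ-fromℕ< r'<m)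
       (≤ᵇ⇒≤ _ _ (toT (allᶠ⇒ {m} _ e (fromℕ< r'<m))))))

isCycleMin⇐ : ∀ {m} (v : Vec (Fin m) m) x → IsCycleMin (lookup v) x → isCycleMin v x ≡ true
isCycleMin⇐ {m} v x min = allᶠ⇐ {m} _ (λ r → fromT (≤⇒≤ᵇ
  (subst (λ z → toℕ x ≤ toℕ z) (sym (iter≡iterate v (toℕ r) x)) (min (toℕ r)))))

Invariant : ∀ {m k} → (Fin m → Fin k) → (Fin m → Fin m) → Set
Invariant c F = ∀ x → c (F x) ≡ c x

-- Inserting the new element top into the cycle of F after p: F' agrees with F except that
-- p ↦ top ↦ F p.  Old elements keep their cycle-minimality, top is never a cycle minimum
-- (it is the largest element and shares a cycle with p), and injectivity and invariance of
-- colourings extended by the colour of p are preserved and reflected.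
module InsertAfter {n} (F : Fin n → Fin n) (p : Fin n) (F' : Fin (suc n) → Fin (suc n))
  (F'-old : ∀ y → y ≢ p → F' (inject₁ y) ≡ inject₁ (F y)) (F'-p : F' (inject₁ p) ≡ top)
  (F'-top : F' top ≡ inject₁ (F p)) where

  orbit-F'→F : ∀ r y → (Σ ℕ λ s → iterate F' r (inject₁ y) ≡ inject₁ (iterate F s y))
                     ⊎ (Σ ℕ λ s → iterate F' r (inject₁ y) ≡ top × iterate F s y ≡ p)
  orbit-F'→F zero y = inj₁ (0 , refl)
  orbit-F'→F (suc r) y with orbit-F'→F r y
  ... | inj₂ (s , e , q) = inj₁ (suc s , trans (cong F' e) (trans F'-top (cong (inject₁ ∘ F) (sym q))))
  ... | inj₁ (s , e) with iterate F s y ≟ᶠ p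
  ...   | yes q = inj₂ (s , trans (cong F' e) (trans (cong (F' ∘ inject₁) q) F'-p) , q)
  ...   | no q = inj₁ (suc s , trans (cong F' e) (F'-old _ q))

  orbit-F→F' : ∀ s y → Σ ℕ λ r → iterate F' r (inject₁ y) ≡ inject₁ (iterate F s y)
  orbit-F→F' zero y = 0 , refl
  orbit-F→F' (suc s) y with orbit-F→F' s y
  ... | r , e with iterate F s y ≟ᶠ p
  ...   | yes q = suc (suc r) , trans (cong (F' ∘ F') e) (trans (cong (F' ∘ F' ∘ inject₁) q)
                   (trans (cong F' F'-p) (trans F'-top (cong (inject₁ ∘ F) (sym q)))))
  ...   | no q = suc r , trans (cong F' e) (F'-old _ q)

  cycleMin⇒ : ∀ y → IsCycleMin F y → IsCycleMin F' (inject₁ y)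
  cycleMin⇒ y min r with orbit-F'→F r y
  ... | inj₁ (s , e) = subst (λ z → toℕ (inject₁ y) ≤ toℕ z) (sym e)
                        (subst₂ _≤_ (sym (FinP.toℕ-inject₁ y)) (sym (FinP.toℕ-inject₁ _)) (min s))
  ... | inj₂ (s , e , _) = subst (λ z → toℕ (inject₁ y) ≤ toℕ z) (sym e) (<⇒≤ (inject₁<top y))

  cycleMin⇐ : ∀ y → IsCycleMin F' (inject₁ y) → IsCycleMin F y
  cycleMin⇐ y min s with orbit-F→F' s y
  ... | r , e = subst₂ _≤_ (FinP.toℕ-inject₁ y) (FinP.toℕ-inject₁ _)
                  (subst (λ z → toℕ (inject₁ y) ≤ toℕ z) e (min r))

  top-not-cycleMin : ¬ IsCycleMin F' top
  top-not-cycleMin min = <⇒≱ (subst (λ z → toℕ z < toℕ (top {n})) (sym F'-top) (inject₁<top (F p))) (min 1)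

  F'≡top : ∀ y → F' (inject₁ y) ≡ top → y ≡ p
  F'≡top y e with y ≟ᶠ p
  ... | yes q = q
  ... | no q = ⊥-elim (top≢inject₁ (trans (sym e) (F'-old y q)))

  injective⇒ : Injective _≡_ _≡_ F → Injective _≡_ _≡_ F'
  injective⇒ inj {a} {b} e with view a | view b
  ... | ‵fromℕ | ‵fromℕ = refl
  ... | ‵inject₁ y | ‵inject₁ z with y ≟ᶠ p | z ≟ᶠ p
  ...   | yes refl | yes refl = refl
  ...   | yes refl | no q = ⊥-elim (q (F'≡top z (trans (sym e) F'-p)))
  ...   | no q | yes refl = ⊥-elim (q (F'≡top y (trans e F'-p)))
  ...   | no q | no q' = cong inject₁ (inj (FinP.inject₁-injective (trans (sym (F'-old y q)) (trans e (F'-old z q')))))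
  injective⇒ inj e | ‵inject₁ y | ‵fromℕ with y ≟ᶠ p
  ... | yes refl = ⊥-elim (top≢inject₁ (trans (sym F'-p) (trans e F'-top)))
  ... | no q = ⊥-elim (q (inj (FinP.inject₁-injective (trans (sym (F'-old y q)) (trans e F'-top)))))
  injective⇒ inj e | ‵fromℕ | ‵inject₁ y with y ≟ᶠ p
  ... | yes refl = ⊥-elim (top≢inject₁ (trans (sym F'-p) (trans (sym e) F'-top)))
  ... | no q = ⊥-elim (q (inj (FinP.inject₁-injective (trans (sym (F'-old y q)) (trans (sym e) F'-top)))))

  injective⇐ : Injective _≡_ _≡_ F' → Injective _≡_ _≡_ F
  injective⇐ inj {a} {b} e with a ≟ᶠ p | b ≟ᶠ p
  ... | yes refl | yes refl = refl
  ... | yes refl | no q = ⊥-elim (top≢inject₁ (inj (trans F'-top (trans (cong inject₁ e) (sym (F'-old b q))))))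
  ... | no q | yes refl = ⊥-elim (top≢inject₁ (inj (trans F'-top (trans (cong inject₁ (sym e)) (sym (F'-old a q))))))
  ... | no q | no q' = FinP.inject₁-injective (inj (trans (F'-old a q) (trans (cong inject₁ e) (sym (F'-old b q')))))

  module _ {k} (c : Fin n → Fin k) (c' : Fin (suc n) → Fin k)
    (c'-old : ∀ y → c' (inject₁ y) ≡ c y) (c'-top : c' top ≡ c p) where

    invariant⇒ : Invariant c F → Invariant c' F'
    invariant⇒ inv x with view x
    ... | ‵fromℕ = trans (cong c' F'-top) (trans (c'-old _) (trans (inv p) (sym c'-top)))
    ... | ‵inject₁ y with y ≟ᶠ p
    ...   | yes refl = trans (cong c' F'-p) (trans c'-top (sym (c'-old p)))
    ...   | no q = trans (cong c' (F'-old y q)) (trans (c'-old _) (trans (inv y) (sym (c'-old y))))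

    invariant⇐ : Invariant c' F' → Invariant c F
    invariant⇐ inv y with y ≟ᶠ p
    ... | yes refl = trans (sym (c'-old _)) (trans (cong c' (sym F'-top)) (trans (inv top) c'-top))
    ... | no q = trans (sym (c'-old _)) (trans (cong c' (sym (F'-old y q))) (trans (inv _) (c'-old y)))

module InsertFixed {n} (F : Fin n → Fin n) (F' : Fin (suc n) → Fin (suc n))
  (F'-old : ∀ y → F' (inject₁ y) ≡ inject₁ (F y)) (F'-top : F' top ≡ top) where

  orbit-old : ∀ r y → iterate F' r (inject₁ y) ≡ inject₁ (iterate F r y)
  orbit-old zero y = refl
  orbit-old (suc r) y = trans (cong F' (orbit-old r y)) (F'-old _)

  orbit-top : ∀ r → iterate F' r top ≡ top
  orbit-top zero = refl
  orbit-top (suc r) = trans (cong F' (orbit-top r)) F'-top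

  cycleMin⇒ : ∀ y → IsCycleMin F y → IsCycleMin F' (inject₁ y)
  cycleMin⇒ y min r = subst (λ z → toℕ (inject₁ y) ≤ toℕ z) (sym (orbit-old r y))
                        (subst₂ _≤_ (sym (FinP.toℕ-inject₁ y)) (sym (FinP.toℕ-inject₁ _)) (min r))

  cycleMin⇐ : ∀ y → IsCycleMin F' (inject₁ y) → IsCycleMin F y
  cycleMin⇐ y min r = subst₂ _≤_ (FinP.toℕ-inject₁ y) (FinP.toℕ-inject₁ _)
                        (subst (λ z → toℕ (inject₁ y) ≤ toℕ z) (orbit-old r y) (min r))

  top-cycleMin : IsCycleMin F' top
  top-cycleMin r = subst (λ z → toℕ (top {n}) ≤ toℕ z) (sym (orbit-top r)) ≤-refl

  injective⇒ : Injective _≡_ _≡_ F → Injective _≡_ _≡_ F'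
  injective⇒ inj {a} {b} e with view a | view b
  ... | ‵fromℕ | ‵fromℕ = refl
  ... | ‵inject₁ y | ‵inject₁ z = cong inject₁ (inj (FinP.inject₁-injective (trans (sym (F'-old y)) (trans e (F'-old z)))))
  ... | ‵inject₁ y | ‵fromℕ = ⊥-elim (top≢inject₁ (trans (sym F'-top) (trans (sym e) (F'-old y))))
  ... | ‵fromℕ | ‵inject₁ y = ⊥-elim (top≢inject₁ (trans (sym F'-top) (trans e (F'-old y))))

  injective⇐ : Injective _≡_ _≡_ F' → Injective _≡_ _≡_ F
  injective⇐ inj {a} {b} e = FinP.inject₁-injective (inj (trans (F'-old a) (trans (cong inject₁ e) (sym (F'-old b)))))

  module _ {k} (c : Fin n → Fin k) (c' : Fin (suc n) → Fin k) (c'-old : ∀ y → c' (inject₁ y) ≡ c y) where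

    invariant⇒ : Invariant c F → Invariant c' F'
    invariant⇒ inv x with view x
    ... | ‵fromℕ = cong c' F'-top
    ... | ‵inject₁ y = trans (cong c' (F'-old y)) (trans (c'-old _) (trans (inv y) (sym (c'-old y))))

    invariant⇐ : Invariant c' F' → Invariant c F
    invariant⇐ inv y = trans (sym (c'-old _)) (trans (cong c' (sym (F'-old y))) (trans (inv _) (c'-old y)))

isPerm⇒ : ∀ {m} (v : Vec (Fin m) m) → isPerm v ≡ true → Injective _≡_ _≡_ (lookup v)
isPerm⇒ {m} v e {a} {b} va≡vb with allᶠ⇒ {m} _ (allᶠ⇒ {m} _ e a) b
... | test with lookup v a ≟ᶠ lookup v b
...   | yes _ = ≟-true test
...   | no va≢vb = ⊥-elim (va≢vb va≡vb)

isPerm⇐ : ∀ {m} (v : Vec (Fin m) m) → Injective _≡_ _≡_ (lookup v) → isPerm v ≡ true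
isPerm⇐ {m} v inj = allᶠ⇐ {m} _ (λ a → allᶠ⇐ {m} _ (λ b → test a b))
  where
  test : ∀ a b → (if ⌊ lookup v a ≟ᶠ lookup v b ⌋ then ⌊ a ≟ᶠ b ⌋ else true) ≡ true
  test a b with lookup v a ≟ᶠ lookup v b
  ... | yes va≡vb = subst (λ z → ⌊ a ≟ᶠ z ⌋ ≡ true) (inj va≡vb) (≟-refl a)
  ... | no _ = refl

isInvariant : ∀ {m k} (v : Vec (Fin m) m) (c : Vec (Fin k) m) → Bool
isInvariant {m} v c = allᶠ {m} (λ i → ⌊ lookup c (lookup v i) ≟ᶠ lookup c i ⌋)

isInvariant⇒ : ∀ {m k} (v : Vec (Fin m) m) (c : Vec (Fin k) m) → isInvariant v c ≡ true → Invariant (lookup c) (lookup v)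
isInvariant⇒ {m} v c e x = ≟-true (allᶠ⇒ {m} _ e x)

isInvariant⇐ : ∀ {m k} (v : Vec (Fin m) m) (c : Vec (Fin k) m) → Invariant (lookup c) (lookup v) → isInvariant v c ≡ true
isInvariant⇐ {m} v c inv = allᶠ⇐ {m} _ (λ x → trans (cong (λ z → ⌊ z ≟ᶠ lookup c x ⌋) (inv x)) (≟-refl _))

-- A coloured permutation of [n+1] arises
-- uniquely from a coloured permutation (v, c) of [n] either by inserting the new element
-- after some p in its cycle (n choices, the colouring of cycles unchanged) or by adding it
-- as a new singleton cycle of some colour j (which needs t_j ≠ 0 and leaves t − e_j on [n]):
--   [n+1 ; t] = n [n ; t] + Σ_j [t_j ≠ 0] [n ; t − e_j].

lowerAt : ∀ {k} → Vec ℕ k → Fin k → Vec ℕ k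
lowerAt t j = Data.Vec.updateAt t j (_∸ 1)

newCycleSum : ∀ {k} → (Vec ℕ k → ℕ) → Vec ℕ k → ℕ
newCycleSum {k} X t = Σl (λ j → ind (not (lookup t j ≡ᵇ 0)) * X (lowerAt t j)) (allFin k)

colourCount : ∀ {m k} (v : Vec (Fin m) m) (c : Vec (Fin k) m) → Fin k → ℕ
colourCount {m} v c j = countᵇ (λ i → isCycleMin v i ∧ ⌊ lookup c i ≟ᶠ j ⌋) (allFin m)

colourCount-extend : ∀ {n k} (v : Vec (Fin n) n) (c : Vec (Fin k) n)
  (v' : Vec (Fin (suc n)) (suc n)) (c' : Vec (Fin k) (suc n)) →
  (∀ y → isCycleMin v' (inject₁ y) ≡ isCycleMin v y) → (∀ y → lookup c' (inject₁ y) ≡ lookup c y) → ∀ j →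
  colourCount v' c' j ≡ colourCount v c j + ind (isCycleMin v' top ∧ ⌊ lookup c' top ≟ᶠ j ⌋)
colourCount-extend {n} v c v' c' sameMin sameColour j = begin
    colourCount v' c' j
  ≡⟨ countΣ _ (allFin (suc n)) ⟩
    Σl (λ i → ind (isCycleMin v' i ∧ ⌊ lookup c' i ≟ᶠ j ⌋)) (allFin (suc n))
  ≡⟨ Σl-last {n} (λ i → ind (isCycleMin v' i ∧ ⌊ lookup c' i ≟ᶠ j ⌋)) ⟩
    Σl (λ y → ind (isCycleMin v' (inject₁ y) ∧ ⌊ lookup c' (inject₁ y) ≟ᶠ j ⌋)) (allFin n)
      + ind (isCycleMin v' top ∧ ⌊ lookup c' top ≟ᶠ j ⌋)
  ≡⟨ cong (_+ _) (Σl-cong (λ y → cong₂ (λ a b → ind (a ∧ ⌊ b ≟ᶠ j ⌋)) (sameMin y) (sameColour y)) (allFin n)) ⟩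
    Σl (λ y → ind (isCycleMin v y ∧ ⌊ lookup c y ≟ᶠ j ⌋)) (allFin n) + ind (isCycleMin v' top ∧ ⌊ lookup c' top ≟ᶠ j ⌋)
  ≡⟨ cong (_+ _) (sym (countΣ _ (allFin n))) ⟩
    colourCount v c j + ind (isCycleMin v' top ∧ ⌊ lookup c' top ≟ᶠ j ⌋)
  ∎

x+1≡ᵇt : ∀ x t → (x + 1 ≡ᵇ t) ≡ not (t ≡ᵇ 0) ∧ (x ≡ᵇ t ∸ 1)
x+1≡ᵇt x zero = cong (_≡ᵇ 0) (+-comm x 1)
x+1≡ᵇt x (suc t) = cong (_≡ᵇ suc t) (+-comm x 1)

counts-newCycle : ∀ {k} (x : Fin k → ℕ) (t : Vec ℕ k) j →
  allᶠ (λ j' → x j' + ind ⌊ j ≟ᶠ j' ⌋ ≡ᵇ lookup t j')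
    ≡ not (lookup t j ≡ᵇ 0) ∧ allᶠ (λ j' → x j' ≡ᵇ lookup (lowerAt t j) j')
counts-newCycle {k} x t j = boolExt to from
  where
  P Q : Fin k → Bool
  P j' = x j' + ind ⌊ j ≟ᶠ j' ⌋ ≡ᵇ lookup t j'
  Q j' = x j' ≡ᵇ lookup (lowerAt t j) j'
  at-j : P j ≡ not (lookup t j ≡ᵇ 0) ∧ Q j
  at-j = begin
      x j + ind ⌊ j ≟ᶠ j ⌋ ≡ᵇ lookup t j         ≡⟨ cong (λ b → x j + ind b ≡ᵇ lookup t j) (≟-refl j) ⟩
      x j + 1 ≡ᵇ lookup t j                      ≡⟨ x+1≡ᵇt (x j) (lookup t j) ⟩
      not (lookup t j ≡ᵇ 0) ∧ (x j ≡ᵇ lookup t j ∸ 1)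
        ≡⟨ cong (λ s → not (lookup t j ≡ᵇ 0) ∧ (x j ≡ᵇ s)) (sym (VecP.lookup∘updateAt j t)) ⟩
      not (lookup t j ≡ᵇ 0) ∧ Q j                ∎
  elsewhere : ∀ j' → j' ≢ j → P j' ≡ Q j'
  elsewhere j' j'≢j = cong₂ _≡ᵇ_ (trans (cong (λ b → x j' + ind b) (≟-false (j'≢j ∘ sym))) (+-identityʳ _))
                                 (sym (VecP.lookup∘updateAt′ j' j j'≢j t))
  to : allᶠ P ≡ true → not (lookup t j ≡ᵇ 0) ∧ allᶠ Q ≡ true
  to all = ∧-intro (proj₁ (∧-true (trans (sym at-j) (allᶠ⇒ P all j)))) (allᶠ⇐ Q Q-holds)
    where
    Q-holds : ∀ j' → Q j' ≡ true
    Q-holds j' with j' ≟ᶠ j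
    ... | yes refl = proj₂ (∧-true {not (lookup t j ≡ᵇ 0)} (trans (sym at-j) (allᶠ⇒ P all j)))
    ... | no j'≢j = trans (sym (elsewhere j' j'≢j)) (allᶠ⇒ P all j')
  from : not (lookup t j ≡ᵇ 0) ∧ allᶠ Q ≡ true → allᶠ P ≡ true
  from both = allᶠ⇐ P P-holds
    where
    P-holds : ∀ j' → P j' ≡ true
    P-holds j' with j' ≟ᶠ j
    ... | yes refl = trans at-j (∧-intro (proj₁ (∧-true both)) (allᶠ⇒ Q (proj₂ (∧-true {not (lookup t j ≡ᵇ 0)} both)) j))
    ... | no j'≢j = trans (elsewhere j' j'≢j) (allᶠ⇒ Q (proj₂ (∧-true {not (lookup t j ≡ᵇ 0)} both)) j')

afterMap : ∀ {n} → Vec (Fin n) n → Fin n → Fin (suc n) → Fin (suc n)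
afterMap v p = extendTop (λ y → if ⌊ y ≟ᶠ p ⌋ then top else inject₁ (lookup v y)) (inject₁ (lookup v p))

fixedMap : ∀ {n} → Vec (Fin n) n → Fin (suc n) → Fin (suc n)
fixedMap v = extendTop (inject₁ ∘ lookup v) top

extendColour : ∀ {n k} → Vec (Fin k) n → Fin k → Vec (Fin k) (suc n)
extendColour c a = tabulate (extendTop (lookup c) a)

extendColour-old : ∀ {n k} (c : Vec (Fin k) n) a y → lookup (extendColour c a) (inject₁ y) ≡ lookup c y
extendColour-old c a y = trans (VecP.lookup∘tabulate (extendTop (lookup c) a) (inject₁ y)) (extendTop-inject₁ (lookup c) a y)

extendColour-top : ∀ {n k} (c : Vec (Fin k) n) a → lookup (extendColour c a) top ≡ a
extendColour-top c a = trans (VecP.lookup∘tabulate (extendTop (lookup c) a) top) (extendTop-top (lookup c) a)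

afterMap-old : ∀ {n} (v : Vec (Fin n) n) p y → y ≢ p → lookup (tabulate (afterMap v p)) (inject₁ y) ≡ inject₁ (lookup v y)
afterMap-old v p y y≢p = trans (VecP.lookup∘tabulate (afterMap v p) (inject₁ y))
  (trans (extendTop-inject₁ (λ y → if ⌊ y ≟ᶠ p ⌋ then top else inject₁ (lookup v y)) _ y)
         (cong (λ b → if b then top else inject₁ (lookup v y)) (≟-false y≢p)))

afterMap-p : ∀ {n} (v : Vec (Fin n) n) p → lookup (tabulate (afterMap v p)) (inject₁ p) ≡ top
afterMap-p v p = trans (VecP.lookup∘tabulate (afterMap v p) (inject₁ p))
  (trans (extendTop-inject₁ (λ y → if ⌊ y ≟ᶠ p ⌋ then top else inject₁ (lookup v y)) _ p)
         (cong (λ b → if b then top else inject₁ (lookup v p)) (≟-refl p)))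

afterMap-top : ∀ {n} (v : Vec (Fin n) n) p → lookup (tabulate (afterMap v p)) top ≡ inject₁ (lookup v p)
afterMap-top v p = trans (VecP.lookup∘tabulate (afterMap v p) top)
  (extendTop-top (λ y → if ⌊ y ≟ᶠ p ⌋ then top else inject₁ (lookup v y)) _)

fixedMap-old : ∀ {n} (v : Vec (Fin n) n) y → lookup (tabulate (fixedMap v)) (inject₁ y) ≡ inject₁ (lookup v y)
fixedMap-old v y = trans (VecP.lookup∘tabulate (fixedMap v) (inject₁ y)) (extendTop-inject₁ (inject₁ ∘ lookup v) top y)

fixedMap-top : ∀ {n} (v : Vec (Fin n) n) → lookup (tabulate (fixedMap v)) top ≡ top
fixedMap-top v = trans (VecP.lookup∘tabulate (fixedMap v) top) (extendTop-top (inject₁ ∘ lookup v) top)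

module AfterFacts {n k} (v : Vec (Fin n) n) (c : Vec (Fin k) n) (p : Fin n) where
  v' : Vec (Fin (suc n)) (suc n)
  v' = tabulate (afterMap v p)
  c' : Vec (Fin k) (suc n)
  c' = extendColour c (lookup c p)

  open InsertAfter (lookup v) p (lookup v') (afterMap-old v p) (afterMap-p v p) (afterMap-top v p) public

  isColouredPerm-after : ∀ t → isColouredPerm t v c ≡ isColouredPerm t v' c'
  isColouredPerm-after t = cong₂ _∧_ samePerm (cong₂ _∧_ sameInvariant (allᶠ-cong (λ j → cong (_≡ᵇ lookup t j) (sym (sameCounts j)))))
    where
    samePerm : isPerm v ≡ isPerm v'
    samePerm = boolExt (λ e → isPerm⇐ v' (injective⇒ (isPerm⇒ v e))) (λ e → isPerm⇐ v (injective⇐ (isPerm⇒ v' e)))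
    sameInvariant : isInvariant v c ≡ isInvariant v' c'
    sameInvariant = boolExt
      (λ e → isInvariant⇐ v' c' (invariant⇒ (lookup c) (lookup c') (extendColour-old c _) (extendColour-top c _) (isInvariant⇒ v c e)))
      (λ e → isInvariant⇐ v c (invariant⇐ (lookup c) (lookup c') (extendColour-old c _) (extendColour-top c _) (isInvariant⇒ v' c' e)))
    sameMin : ∀ y → isCycleMin v' (inject₁ y) ≡ isCycleMin v y
    sameMin y = boolExt (λ e → isCycleMin⇐ v y (cycleMin⇐ y (isCycleMin⇒ v' _ e)))
                        (λ e → isCycleMin⇐ v' _ (cycleMin⇒ y (isCycleMin⇒ v y e)))
    top-not-min : isCycleMin v' top ≡ false
    top-not-min with isCycleMin v' top in e
    ... | true = ⊥-elim (top-not-cycleMin (isCycleMin⇒ v' top e))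
    ... | false = refl
    sameCounts : ∀ j → colourCount v' c' j ≡ colourCount v c j
    sameCounts j = trans (colourCount-extend v c v' c' sameMin (extendColour-old c _) j)
                         (trans (cong (λ b → colourCount v c j + ind (b ∧ ⌊ lookup c' top ≟ᶠ j ⌋)) top-not-min) (+-identityʳ _))

module FixedFacts {n k} (v : Vec (Fin n) n) (c : Vec (Fin k) n) (j : Fin k) where
  v' : Vec (Fin (suc n)) (suc n)
  v' = tabulate (fixedMap v)
  c' : Vec (Fin k) (suc n)
  c' = extendColour c j

  open InsertFixed (lookup v) (lookup v') (fixedMap-old v) (fixedMap-top v)

  isColouredPerm-fixed : ∀ t → not (lookup t j ≡ᵇ 0) ∧ isColouredPerm (lowerAt t j) v c ≡ isColouredPerm t v' c'
  isColouredPerm-fixed t = begin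
      z ∧ (isPerm v ∧ (isInvariant v c ∧ allᶠ (λ j' → colourCount v c j' ≡ᵇ lookup (lowerAt t j) j')))
    ≡⟨ ∧-rotate z (isPerm v) (isInvariant v c) _ ⟩
      isPerm v ∧ (isInvariant v c ∧ (z ∧ allᶠ (λ j' → colourCount v c j' ≡ᵇ lookup (lowerAt t j) j')))
    ≡⟨ cong₂ _∧_ samePerm (cong₂ _∧_ sameInvariant (sym (counts-newCycle (colourCount v c) t j))) ⟩
      isPerm v' ∧ (isInvariant v' c' ∧ allᶠ (λ j' → colourCount v c j' + ind ⌊ j ≟ᶠ j' ⌋ ≡ᵇ lookup t j'))
    ≡⟨ cong (λ b → isPerm v' ∧ (isInvariant v' c' ∧ b)) (allᶠ-cong (λ j' → cong (_≡ᵇ lookup t j') (sym (newCounts j')))) ⟩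
      isColouredPerm t v' c'
    ∎
    where
    z : Bool
    z = not (lookup t j ≡ᵇ 0)
    ∧-rotate : ∀ z a b x → z ∧ (a ∧ (b ∧ x)) ≡ a ∧ (b ∧ (z ∧ x))
    ∧-rotate false false b x = refl
    ∧-rotate false true false x = refl
    ∧-rotate false true true x = refl
    ∧-rotate true a b x = refl
    samePerm : isPerm v ≡ isPerm v'
    samePerm = boolExt (λ e → isPerm⇐ v' (injective⇒ (isPerm⇒ v e))) (λ e → isPerm⇐ v (injective⇐ (isPerm⇒ v' e)))
    sameInvariant : isInvariant v c ≡ isInvariant v' c'
    sameInvariant = boolExt
      (λ e → isInvariant⇐ v' c' (invariant⇒ (lookup c) (lookup c') (extendColour-old c _) (isInvariant⇒ v c e)))
      (λ e → isInvariant⇐ v c (invariant⇐ (lookup c) (lookup c') (extendColour-old c _) (isInvariant⇒ v' c' e)))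
    sameMin : ∀ y → isCycleMin v' (inject₁ y) ≡ isCycleMin v y
    sameMin y = boolExt (λ e → isCycleMin⇐ v y (cycleMin⇐ y (isCycleMin⇒ v' _ e)))
                        (λ e → isCycleMin⇐ v' _ (cycleMin⇒ y (isCycleMin⇒ v y e)))
    newCounts : ∀ j' → colourCount v' c' j' ≡ colourCount v c j' + ind ⌊ j ≟ᶠ j' ⌋
    newCounts j' = trans (colourCount-extend v c v' c' sameMin (extendColour-old c _) j')
      (cong₂ (λ a b → colourCount v c j' + ind (a ∧ ⌊ b ≟ᶠ j' ⌋)) (isCycleMin⇐ v' top top-cycleMin) (extendColour-top c j))

tabulate-ext : ∀ {A : Set} {m} (f : Fin m → A) (v : Vec A m) → (∀ i → f i ≡ lookup v i) → tabulate f ≡ v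
tabulate-ext f v e = trans (VecP.tabulate-cong e) (VecP.tabulate∘lookup v)

restrictColour : ∀ {n k} → Vec (Fin k) (suc n) → Vec (Fin k) n
restrictColour c' = tabulate (lookup c' ∘ inject₁)

restrictColour-extend : ∀ {n k} (c : Vec (Fin k) n) a → restrictColour (extendColour c a) ≡ c
restrictColour-extend c a = tabulate-ext _ c (extendColour-old c a)

extendColour-restrict : ∀ {n k} (c' : Vec (Fin k) (suc n)) a → lookup c' top ≡ a → extendColour (restrictColour c') a ≡ c'
extendColour-restrict {n} c' a c'-top = tabulate-ext _ c' agree
  where
  agree : ∀ x → extendTop (lookup (restrictColour c')) a x ≡ lookup c' x
  agree x with view x
  ... | ‵fromℕ = trans (extendTop-top {n = n} _ a) (sym c'-top)
  ... | ‵inject₁ y = trans (extendTop-inject₁ {n = n} _ a y) (VecP.lookup∘tabulate (lookup c' ∘ inject₁) y)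

removeFixed : ∀ {n} → Vec (Fin (suc n)) (suc n) → Vec (Fin n) n
removeFixed v' = tabulate (λ y → lowerOr y (lookup v' (inject₁ y)))

removeAfter : ∀ {n} → Vec (Fin (suc n)) (suc n) → Fin n → Vec (Fin n) n
removeAfter v' p = tabulate (λ y → lowerOr y (lookup v' (if ⌊ y ≟ᶠ p ⌋ then top else inject₁ y)))

removeFixed-fixedMap : ∀ {n} (v : Vec (Fin n) n) → removeFixed (tabulate (fixedMap v)) ≡ v
removeFixed-fixedMap v = tabulate-ext _ v (λ y → trans (cong (lowerOr y) (fixedMap-old v y)) (lowerOr-inject₁ y _))

removeAfter-afterMap : ∀ {n} (v : Vec (Fin n) n) p → removeAfter (tabulate (afterMap v p)) p ≡ v
removeAfter-afterMap v p = tabulate-ext _ v restore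
  where
  restore : ∀ y → lowerOr y (lookup (tabulate (afterMap v p)) (if ⌊ y ≟ᶠ p ⌋ then top else inject₁ y)) ≡ lookup v y
  restore y with y ≟ᶠ p
  ... | yes refl = trans (cong (lowerOr y) (afterMap-top v y)) (lowerOr-inject₁ y _)
  ... | no y≢p = trans (cong (lowerOr y) (afterMap-old v p y y≢p)) (lowerOr-inject₁ y _)

fixedMap-removeFixed : ∀ {n} (v' : Vec (Fin (suc n)) (suc n)) → Injective _≡_ _≡_ (lookup v') →
  lookup v' top ≡ top → tabulate (fixedMap (removeFixed v')) ≡ v'
fixedMap-removeFixed {n} v' inj v'-top = tabulate-ext _ v' restore
  where
  restore : ∀ x → fixedMap (removeFixed v') x ≡ lookup v' x
  restore x with view x
  ... | ‵fromℕ = trans (extendTop-top {n = n} _ top) (sym v'-top)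
  ... | ‵inject₁ y = trans (extendTop-inject₁ {n = n} _ top y)
      (trans (cong inject₁ (VecP.lookup∘tabulate (λ y → lowerOr y (lookup v' (inject₁ y))) y))
             (inject₁-lowerOr y _ (λ e → top≢inject₁ (sym (inj (trans e (sym v'-top)))))))

afterMap-removeAfter : ∀ {n} (v' : Vec (Fin (suc n)) (suc n)) p → Injective _≡_ _≡_ (lookup v') →
  lookup v' (inject₁ p) ≡ top → tabulate (afterMap (removeAfter v' p) p) ≡ v'
afterMap-removeAfter {n} v' p inj v'-p = tabulate-ext _ v' restore
  where
  w : Vec (Fin n) n
  w = removeAfter v' p
  w-at : ∀ y → lookup w y ≡ lowerOr y (lookup v' (if ⌊ y ≟ᶠ p ⌋ then top else inject₁ y))
  w-at y = VecP.lookup∘tabulate (λ y → lowerOr y (lookup v' (if ⌊ y ≟ᶠ p ⌋ then top else inject₁ y))) y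
  restore : ∀ x → afterMap w p x ≡ lookup v' x
  restore x with view x
  ... | ‵fromℕ = trans (extendTop-top {n = n} _ _)
      (trans (cong inject₁ (trans (w-at p) (cong (λ b → lowerOr p (lookup v' (if b then top else inject₁ p))) (≟-refl p))))
             (inject₁-lowerOr p _ (λ e → top≢inject₁ (inj (trans e (sym v'-p))))))
  ... | ‵inject₁ y with y ≟ᶠ p
  ...   | yes refl = trans (extendTop-inject₁ {n = n} _ _ y)
      (trans (cong (λ b → if b then top else inject₁ (lookup w y)) (≟-refl y)) (sym v'-p))
  ...   | no y≢p = trans (extendTop-inject₁ {n = n} _ _ y)
      (trans (cong (λ b → if b then top else inject₁ (lookup w y)) (≟-false y≢p))
      (trans (cong inject₁ (trans (w-at y) (cong (λ b → lowerOr y (lookup v' (if b then top else inject₁ y))) (≟-false y≢p))))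
             (inject₁-lowerOr y _ (λ e → y≢p (FinP.inject₁-injective (inj (trans e (sym v'-p))))))))

-- An injective endomap of Fin (suc n) hits top: otherwise punching top out would give an
-- injection Fin (suc n) → Fin n, contradicting the pigeonhole principle.
injective-hits-top : ∀ {n} (F : Fin (suc n) → Fin (suc n)) → Injective _≡_ _≡_ F →
  F top ≢ top → ¬ (∃ λ y → F (inject₁ y) ≡ top) → ⊥
injective-hits-top {n} F inj F-top≢top missed = collision (FinP.pigeonhole (n<1+n n) squeezed)
  where
  avoids : ∀ x → top ≢ F x
  avoids x e with view x
  ... | ‵fromℕ = F-top≢top (sym e)
  ... | ‵inject₁ y = missed (y , sym e)
  squeezed : Fin (suc n) → Fin n
  squeezed x = punchOut (avoids x)
  collision : (∃ λ i → ∃ λ j → i Data.Fin.< j × squeezed i ≡ squeezed j) → ⊥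
  collision (i , j , i<j , e) = <-irrefl (cong toℕ (inj (FinP.punchOut-injective (avoids i) (avoids j) e))) i<j

-- A coloured map of [n] together with a mark: an element p (insert top after p) or a
-- colour j (add top as a singleton cycle of colour j).
Marked : ℕ → ℕ → Set
Marked n k = (Vec (Fin n) n × Vec (Fin k) n) × (Fin n ⊎ Fin k)

isMarkedPerm : ∀ {n k} → Vec ℕ k → Marked n k → Bool
isMarkedPerm t ((v , c) , inj₁ p) = isColouredPerm t v c
isMarkedPerm t ((v , c) , inj₂ j) = not (lookup t j ≡ᵇ 0) ∧ isColouredPerm (lowerAt t j) v c

insert : ∀ {n k} → Marked n k → Vec (Fin (suc n)) (suc n) × Vec (Fin k) (suc n)
insert ((v , c) , inj₁ p) = tabulate (afterMap v p) , extendColour c (lookup c p)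
insert ((v , c) , inj₂ j) = tabulate (fixedMap v) , extendColour c j

-- Whether top is a fixed point is read off from whether some old element is sent to top.
removeBy : ∀ {n k} (v' : Vec (Fin (suc n)) (suc n)) → Vec (Fin k) (suc n) →
  Dec (∃ λ y → lookup v' (inject₁ y) ≡ top) → Marked n k
removeBy v' c' (yes (p , _)) = (removeAfter v' p , restrictColour c') , inj₁ p
removeBy v' c' (no _) = (removeFixed v' , restrictColour c') , inj₂ (lookup c' top)

remove : ∀ {n k} → Vec (Fin (suc n)) (suc n) × Vec (Fin k) (suc n) → Marked n k
remove (v' , c') = removeBy v' c' (FinP.any? (λ y → lookup v' (inject₁ y) ≟ᶠ top))

isMarkedPerm≡isColouredPerm∘insert : ∀ {n k} (t : Vec ℕ k) (a : Marked n k) →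
  isMarkedPerm t a ≡ uncurry (isColouredPerm t) (insert a)
isMarkedPerm≡isColouredPerm∘insert t ((v , c) , inj₁ p) = AfterFacts.isColouredPerm-after v c p t
isMarkedPerm≡isColouredPerm∘insert t ((v , c) , inj₂ j) = FixedFacts.isColouredPerm-fixed v c j t

remove∘insert : ∀ {n k} (a : Marked n k) → remove (insert a) ≡ a
remove∘insert {n} ((v , c) , inj₁ p) = removed (FinP.any? _)
  where
  v' : Vec (Fin (suc n)) (suc n)
  v' = tabulate (afterMap v p)
  removed : ∀ d → removeBy v' (extendColour c (lookup c p)) d ≡ ((v , c) , inj₁ p)
  removed (yes (q , v'q≡top)) with AfterFacts.F'≡top v c p q v'q≡top
  ... | refl = cong₂ (λ w c₀ → (w , c₀) , inj₁ p) (removeAfter-afterMap v p) (restrictColour-extend c _)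
  removed (no none) = ⊥-elim (none (p , afterMap-p v p))
remove∘insert {n} ((v , c) , inj₂ j) = removed (FinP.any? _)
  where
  v' : Vec (Fin (suc n)) (suc n)
  v' = tabulate (fixedMap v)
  removed : ∀ d → removeBy v' (extendColour c j) d ≡ ((v , c) , inj₂ j)
  removed (yes (q , v'q≡top)) = ⊥-elim (top≢inject₁ (trans (sym v'q≡top) (fixedMap-old v q)))
  removed (no _) = cong₂ (λ w (c₀ , a) → (w , c₀) , inj₂ a) (removeFixed-fixedMap v)
                         (cong₂ _,_ (restrictColour-extend c j) (extendColour-top c j))

insert∘remove : ∀ {n k} (t : Vec ℕ k) (b : Vec (Fin (suc n)) (suc n) × Vec (Fin k) (suc n)) →
  uncurry (isColouredPerm t) b ≡ true → insert (remove b) ≡ b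
insert∘remove t (v' , c') coloured = restored (FinP.any? (λ y → lookup v' (inject₁ y) ≟ᶠ top))
  where
  inj : Injective _≡_ _≡_ (lookup v')
  inj = isPerm⇒ v' (proj₁ (∧-true coloured))
  inv : Invariant (lookup c') (lookup v')
  inv = isInvariant⇒ v' c' (proj₁ (∧-true (proj₂ (∧-true {isPerm v'} coloured))))
  restored : ∀ d → insert (removeBy v' c' d) ≡ (v' , c')
  restored (yes (p , v'p≡top)) = cong₂ _,_ (afterMap-removeAfter v' p inj v'p≡top)
    (extendColour-restrict c' _ (trans (cong (lookup c') (sym v'p≡top))
      (trans (inv (inject₁ p)) (sym (VecP.lookup∘tabulate (lookup c' ∘ inject₁) p)))))
  restored (no none) = cong₂ _,_ (fixedMap-removeFixed v' inj v'-top) (extendColour-restrict c' _ refl)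
    where
    v'-top : lookup v' top ≡ top
    v'-top with lookup v' top ≟ᶠ top
    ... | yes e = e
    ... | no ne = ⊥-elim (injective-hits-top (lookup v') inj ne none)

marks : ∀ n k → List (Fin n ⊎ Fin k)
marks n k = map inj₁ (allFin n) ++ map inj₂ (allFin k)

marks-unique : ∀ n k → Unique (marks n k)
marks-unique n k = UniqueP.++⁺ (UniqueP.map⁺ inj₁-injective (UniqueP.allFin⁺ n))
                               (UniqueP.map⁺ inj₂-injective (UniqueP.allFin⁺ k)) disjoint
  where
  disjoint : ∀ {x} → (x ∈ map inj₁ (allFin n) × x ∈ map inj₂ (allFin k)) → ⊥
  disjoint (left , right) with ∈-map⁻ inj₁ left | ∈-map⁻ inj₂ right
  ... | _ , _ , refl | _ , _ , ()

marks-complete : ∀ n k (x : Fin n ⊎ Fin k) → x ∈ marks n k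
marks-complete n k (inj₁ p) = ∈-++⁺ˡ (∈-map⁺ inj₁ (∈-allFin p))
marks-complete n k (inj₂ j) = ∈-++⁺ʳ (map inj₁ (allFin n)) (∈-map⁺ inj₂ (∈-allFin j))

allMarked : ∀ n k → List (Marked n k)
allMarked n k = cartesianProduct (allPairs n k) (marks n k)

marks-sum : ∀ {n k} (t : Vec ℕ k) (vc : Vec (Fin n) n × Vec (Fin k) n) →
  Σl (λ x → ind (isMarkedPerm t (vc , x))) (marks n k)
    ≡ n * ind (uncurry (isColouredPerm t) vc)
      + Σl (λ j → ind (not (lookup t j ≡ᵇ 0)) * ind (uncurry (isColouredPerm (lowerAt t j)) vc)) (allFin k)
marks-sum {n} {k} t (v , c) = begin
    Σl (λ x → ind (isMarkedPerm t ((v , c) , x))) (marks n k)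
  ≡⟨ Σl-++ _ (map inj₁ (allFin n)) _ ⟩
    Σl (λ x → ind (isMarkedPerm t ((v , c) , x))) (map inj₁ (allFin n))
      + Σl (λ x → ind (isMarkedPerm t ((v , c) , x))) (map inj₂ (allFin k))
  ≡⟨ cong₂ _+_ (trans (Σl-map _ inj₁ (allFin n)) (trans (Σl-const _ (allFin n)) (cong (_* ind (isColouredPerm t v c)) (ListP.length-tabulate {n = n} id))))
               (trans (Σl-map _ inj₂ (allFin k)) (Σl-cong (λ j → ind-∧ (not (lookup t j ≡ᵇ 0)) _) (allFin k))) ⟩
    n * ind (isColouredPerm t v c) + Σl (λ j → ind (not (lookup t j ≡ᵇ 0)) * ind (isColouredPerm (lowerAt t j) v c)) (allFin k)
  ∎

colouredStirling-suc : ∀ n {k} (t : Vec ℕ k) →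
  colouredStirling (suc n) t ≡ n * colouredStirling n t + newCycleSum (colouredStirling n) t
colouredStirling-suc n {k} t = begin
    colouredStirling (suc n) t
  ≡⟨ sym (count-bijection (allMarked n k) (allPairs (suc n) k) marked-unique (allPairs-unique (suc n) k)
          marked-complete (allPairs-complete (suc n) k) (isMarkedPerm t) (uncurry (isColouredPerm t))
          insert remove (isMarkedPerm≡isColouredPerm∘insert t) (λ a _ → remove∘insert a) (insert∘remove t)) ⟩
    countᵇ (isMarkedPerm t) (allMarked n k)
  ≡⟨ countΣ (isMarkedPerm t) (allMarked n k) ⟩
    Σl (ind ∘ isMarkedPerm t) (allMarked n k)
  ≡⟨ Σl-cartesian (ind ∘ isMarkedPerm t) _,_ (allPairs n k) (marks n k) ⟩
    Σl (λ vc → Σl (λ x → ind (isMarkedPerm t (vc , x))) (marks n k)) (allPairs n k)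
  ≡⟨ Σl-cong (marks-sum t) (allPairs n k) ⟩
    Σl (λ vc → n * ind (coloured t vc) + Σl (λ j → z j * ind (coloured (lowerAt t j) vc)) (allFin k)) (allPairs n k)
  ≡⟨ Σl-+ _ _ (allPairs n k) ⟩
    Σl (λ vc → n * ind (coloured t vc)) (allPairs n k)
      + Σl (λ vc → Σl (λ j → z j * ind (coloured (lowerAt t j) vc)) (allFin k)) (allPairs n k)
  ≡⟨ cong₂ _+_ (Σl-* n _ (allPairs n k)) (Σl-swap _ (allPairs n k) (allFin k)) ⟩
    n * Σl (ind ∘ coloured t) (allPairs n k)
      + Σl (λ j → Σl (λ vc → z j * ind (coloured (lowerAt t j) vc)) (allPairs n k)) (allFin k)
  ≡⟨ cong₂ _+_ (cong (n *_) (sym (countΣ _ (allPairs n k))))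
               (Σl-cong (λ j → trans (Σl-* (z j) _ (allPairs n k)) (cong (z j *_) (sym (countΣ _ (allPairs n k))))) (allFin k)) ⟩
    n * colouredStirling n t + newCycleSum (colouredStirling n) t
  ∎
  where
  coloured : Vec ℕ k → Vec (Fin n) n × Vec (Fin k) n → Bool
  coloured t' = uncurry (isColouredPerm t')
  z : Fin k → ℕ
  z j = ind (not (lookup t j ≡ᵇ 0))
  marked-unique : Unique (allMarked n k)
  marked-unique = UniqueP.cartesianProduct⁺ (allPairs-unique n k) (marks-unique n k)
  marked-complete : ∀ a → a ∈ allMarked n k
  marked-complete (vc , x) = ∈-cartesianProductWith⁺ _,_ (allPairs-complete n k vc) (marks-complete n k x)

-- Ordinary Stirling numbers are the one-colour case, so they obey the same recurrence.

Fin1-unique : (a : Fin 1) → a ≡ zero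
Fin1-unique zero = refl

stirling1≡colouredStirling : ∀ n m → stirling1 n m ≡ colouredStirling n (m ∷ [])
stirling1≡colouredStirling n m =
  count-bijection (allVecs n n) (allPairs n 1) (allVecs-unique n n) (allPairs-unique n 1)
    (allVecs-complete n n) (allPairs-complete n 1) hasCycles (uncurry (isColouredPerm (m ∷ [])))
    (λ v → v , monochrome) proj₁ sameTest (λ _ _ → refl)
    (λ { (v , c) _ → cong (v ,_) (tabulate-ext _ c (λ i → trans (sym (Fin1-unique _)) (sym (Fin1-unique _)))) })
  where
  monochrome : Vec (Fin 1) n
  monochrome = tabulate (λ _ → zero)
  hasCycles : Vec (Fin n) n → Bool
  hasCycles v = isPerm v ∧ (numCycles v ≡ᵇ m)
  sameTest : ∀ v → hasCycles v ≡ isColouredPerm (m ∷ []) v monochrome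
  sameTest v = cong (isPerm v ∧_) (sym (cong₂ _∧_ invariant (trans (∧-identityʳ _) (cong (_≡ᵇ m) allCycles))))
    where
    invariant : isInvariant v monochrome ≡ true
    invariant = isInvariant⇐ v monochrome (λ x → trans (Fin1-unique _) (sym (Fin1-unique _)))
    allCycles : colourCount v monochrome zero ≡ numCycles v
    allCycles = countᵇ-cong (λ i → trans (cong (λ b → isCycleMin v i ∧ ⌊ b ≟ᶠ zero ⌋) (Fin1-unique (lookup monochrome i)))
                                         (∧-identityʳ _)) (allFin n)

stirling1-suc : ∀ n m → stirling1 (suc n) m ≡ n * stirling1 n m + ind (not (m ≡ᵇ 0)) * stirling1 n (m ∸ 1)
stirling1-suc n m = begin
    stirling1 (suc n) m
  ≡⟨ stirling1≡colouredStirling (suc n) m ⟩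
    colouredStirling (suc n) (m ∷ [])
  ≡⟨ colouredStirling-suc n (m ∷ []) ⟩
    n * colouredStirling n (m ∷ []) + (ind (not (m ≡ᵇ 0)) * colouredStirling n ((m ∸ 1) ∷ []) + 0)
  ≡⟨ cong₂ _+_ (cong (n *_) (sym (stirling1≡colouredStirling n m)))
               (trans (+-identityʳ _) (cong (ind (not (m ≡ᵇ 0)) *_) (sym (stirling1≡colouredStirling n (m ∸ 1))))) ⟩
    n * stirling1 n m + ind (not (m ≡ᵇ 0)) * stirling1 n (m ∸ 1)
  ∎

-- Base cases: only the empty colouring of the empty permutation exists.
-- t = 0
allZero : ∀ {k} → Vec ℕ k → Bool
allZero {k} t = allᶠ {k} (λ j → 0 ≡ᵇ lookup t j)

allZero-∷ : ∀ {k} a (t : Vec ℕ k) → allZero (a ∷ t) ≡ (0 ≡ᵇ a) ∧ allZero t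
allZero-∷ {k} a t = cong ((0 ≡ᵇ a) ∧_) (boolExt
   (λ e → allᶠ⇐ {k} _ (λ j → allTab⇒ suc (λ j → 0 ≡ᵇ lookup (a ∷ t) j) e j))
   (λ e → allTab⇐ suc (λ j → 0 ≡ᵇ lookup (a ∷ t) j) (λ j → allᶠ⇒ {k} _ e j)))

colouredStirling-zero : ∀ {k} (t : Vec ℕ k) → colouredStirling 0 t ≡ ind (allZero t)
colouredStirling-zero {k} t = trans (countΣ (uncurry (isColouredPerm t)) (allPairs 0 k)) (+-identityʳ _)

stirling1-zero : ∀ m → stirling1 0 m ≡ ind (0 ≡ᵇ m)
stirling1-zero m = trans (countΣ (λ v → isPerm v ∧ (numCycles v ≡ᵇ m)) (allVecs 0 0)) (+-identityʳ _)

-- Binomial convolution, the coefficientwise form of the product of exponential generating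
-- functions:  (f ⋆ g)(n) = Σ_{i ≤ n} C(n,i) f(i) g(n − i).

sumTo : ℕ → (ℕ → ℕ) → ℕ
sumTo zero h = h 0
sumTo (suc n) h = sumTo n h + h (suc n)

sumTo-cong : ∀ n {h h' : ℕ → ℕ} → (∀ i → i ≤ n → h i ≡ h' i) → sumTo n h ≡ sumTo n h'
sumTo-cong zero e = e 0 z≤n
sumTo-cong (suc n) e = cong₂ _+_ (sumTo-cong n (λ i i≤n → e i (m≤n⇒m≤1+n i≤n))) (e (suc n) ≤-refl)

sumTo-+ : ∀ n (h h' : ℕ → ℕ) → sumTo n (λ i → h i + h' i) ≡ sumTo n h + sumTo n h'
sumTo-+ zero h h' = refl
sumTo-+ (suc n) h h' rewrite sumTo-+ n h h' = +-interchange (sumTo n h) (sumTo n h') (h (suc n)) (h' (suc n))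
  where
  +-interchange : ∀ a b c d → a + b + (c + d) ≡ a + c + (b + d)
  +-interchange = solve-∀

sumTo-* : ∀ n c (h : ℕ → ℕ) → sumTo n (λ i → c * h i) ≡ c * sumTo n h
sumTo-* zero c h = refl
sumTo-* (suc n) c h rewrite sumTo-* n c h = sym (*-distribˡ-+ c (sumTo n h) (h (suc n)))

sumTo-first : ∀ n (h : ℕ → ℕ) → sumTo (suc n) h ≡ h 0 + sumTo n (h ∘ suc)
sumTo-first zero h = refl
sumTo-first (suc n) h rewrite sumTo-first n h = +-assoc (h 0) _ _

sumTo-vanishing : ∀ n d (h : ℕ → ℕ) → (∀ i → n < i → h i ≡ 0) → sumTo (d + n) h ≡ sumTo n h
sumTo-vanishing n zero h vanish = refl
sumTo-vanishing n (suc d) h vanish = trans (cong (_+ h (suc (d + n))) (sumTo-vanishing n d h vanish))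
  (trans (cong (sumTo n h +_) (vanish _ (s≤s (m≤n+m n d)))) (+-identityʳ _))

Σl-allFin : ∀ N (h : ℕ → ℕ) → Σl (h ∘ toℕ) (allFin (suc N)) ≡ sumTo N h
Σl-allFin zero h = +-identityʳ (h 0)
Σl-allFin (suc N) h = trans (Σl-last (h ∘ toℕ))
   (cong₂ _+_ (trans (Σl-cong (λ y → cong h (FinP.toℕ-inject₁ y)) (allFin (suc N))) (Σl-allFin N h))
              (cong h (FinP.toℕ-fromℕ (suc N))))

_⋆_ : (ℕ → ℕ) → (ℕ → ℕ) → ℕ → ℕ
(f ⋆ g) n = sumTo n (λ i → (n C i) * (f i * g (n ∸ i)))

⋆-cong : ∀ {f f' g g' : ℕ → ℕ} → (∀ i → f i ≡ f' i) → (∀ i → g i ≡ g' i) → ∀ n → (f ⋆ g) n ≡ (f' ⋆ g') n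
⋆-cong ef eg n = sumTo-cong n (λ i _ → cong ((n C i) *_) (cong₂ _*_ (ef i) (eg (n ∸ i))))

⋆-+ˡ : ∀ (f f' g : ℕ → ℕ) n → ((λ i → f i + f' i) ⋆ g) n ≡ (f ⋆ g) n + (f' ⋆ g) n
⋆-+ˡ f f' g n = trans (sumTo-cong n (λ i _ → distrib (n C i) (f i) (f' i) (g (n ∸ i)))) (sumTo-+ n _ _)
  where
  distrib : ∀ b x y z → b * ((x + y) * z) ≡ b * (x * z) + b * (y * z)
  distrib = solve-∀

⋆-+ʳ : ∀ (f g g' : ℕ → ℕ) n → (f ⋆ (λ i → g i + g' i)) n ≡ (f ⋆ g) n + (f ⋆ g') n
⋆-+ʳ f g g' n = trans (sumTo-cong n (λ i _ → distrib (n C i) (f i) (g (n ∸ i)) (g' (n ∸ i)))) (sumTo-+ n _ _)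
  where
  distrib : ∀ b x y z → b * (x * (y + z)) ≡ b * (x * y) + b * (x * z)
  distrib = solve-∀

⋆-*ˡ : ∀ c (f g : ℕ → ℕ) n → ((λ i → c * f i) ⋆ g) n ≡ c * (f ⋆ g) n
⋆-*ˡ c f g n = trans (sumTo-cong n (λ i _ → pull (n C i) c (f i) (g (n ∸ i)))) (sumTo-* n c _)
  where
  pull : ∀ b c x z → b * ((c * x) * z) ≡ c * (b * (x * z))
  pull = solve-∀

⋆-*ʳ : ∀ c (f g : ℕ → ℕ) n → (f ⋆ (λ i → c * g i)) n ≡ c * (f ⋆ g) n
⋆-*ʳ c f g n = trans (sumTo-cong n (λ i _ → pull (n C i) c (f i) (g (n ∸ i)))) (sumTo-* n c _)
  where
  pull : ∀ b c x z → b * (x * (c * z)) ≡ c * (b * (x * z))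
  pull = solve-∀

⋆-Σʳ : ∀ {A : Set} (f : ℕ → ℕ) (H : A → ℕ → ℕ) js n →
  (f ⋆ (λ m → Σl (λ j → H j m) js)) n ≡ Σl (λ j → (f ⋆ H j) n) js
⋆-Σʳ f H [] n = ⋆-*ʳ 0 f (λ _ → 0) n
⋆-Σʳ f H (j ∷ js) n = trans (⋆-+ʳ f (H j) (λ m → Σl (λ j → H j m) js) n) (cong ((f ⋆ H j) n +_) (⋆-Σʳ f H js n))

-- Leibniz rule (the derivative of a product of EGFs):
-- (f ⋆ g)(n+1) = (f ∘ suc ⋆ g)(n) + (f ⋆ g ∘ suc)(n), by Pascal's rule.
⋆-suc : ∀ (f g : ℕ → ℕ) n → (f ⋆ g) (suc n) ≡ ((f ∘ suc) ⋆ g) n + (f ⋆ (g ∘ suc)) n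
⋆-suc f g n = begin
    (f ⋆ g) (suc n)
  ≡⟨ sumTo-first n _ ⟩
    f0 + sumTo n (λ i → (suc n C suc i) * (f (suc i) * g (n ∸ i)))
  ≡⟨ cong (f0 +_) (sumTo-cong n (λ i _ → cong (_* (f (suc i) * g (n ∸ i))) (sym (nCk+nC[k+1]≡[n+1]C[k+1] n i)))) ⟩
    f0 + sumTo n (λ i → (n C i + n C suc i) * (f (suc i) * g (n ∸ i)))
  ≡⟨ cong (f0 +_) (trans (sumTo-cong n (λ i _ → *-distribʳ-+ (f (suc i) * g (n ∸ i)) (n C i) (n C suc i))) (sumTo-+ n _ _)) ⟩
    f0 + (((f ∘ suc) ⋆ g) n + sumTo n (λ i → (n C suc i) * (f (suc i) * g (n ∸ i))))
  ≡⟨ x+[y+z]≡y+[x+z] f0 (((f ∘ suc) ⋆ g) n) _ ⟩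
    ((f ∘ suc) ⋆ g) n + (f0 + sumTo n (λ i → (n C suc i) * (f (suc i) * g (n ∸ i))))
  ≡⟨ cong (((f ∘ suc) ⋆ g) n +_) (sym (sumTo-first n shifted)) ⟩
    ((f ∘ suc) ⋆ g) n + sumTo (suc n) shifted
  ≡⟨ cong (((f ∘ suc) ⋆ g) n +_) (trans (cong (sumTo n shifted +_) (cong (_* (f (suc n) * g (n ∸ n))) (k>n⇒nCk≡0 (n<1+n n))))
                                        (+-identityʳ _)) ⟩
    ((f ∘ suc) ⋆ g) n + sumTo n shifted
  ≡⟨ cong (((f ∘ suc) ⋆ g) n +_) (sumTo-cong n (λ i i≤n → cong (λ z → (n C i) * (f i * g z)) (+-∸-assoc 1 i≤n))) ⟩
    ((f ∘ suc) ⋆ g) n + (f ⋆ (g ∘ suc)) n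
  ∎
  where
  f0 : ℕ
  f0 = 1 * (f 0 * g (suc n))
  shifted : ℕ → ℕ
  shifted i = (n C i) * (f i * g (suc n ∸ i))
  x+[y+z]≡y+[x+z] : ∀ x y z → x + (y + z) ≡ y + (x + z)
  x+[y+z]≡y+[x+z] = solve-∀

⋆-weighted : ∀ (f g : ℕ → ℕ) n → ((λ i → i * f i) ⋆ g) n + (f ⋆ (λ m → m * g m)) n ≡ n * (f ⋆ g) n
⋆-weighted f g n = trans (sym (sumTo-+ n _ _)) (trans (sumTo-cong n split) (sumTo-* n n _))
  where
  collect : ∀ b i j x y → b * ((i * x) * y) + b * (x * (j * y)) ≡ (i + j) * (b * (x * y))
  collect = solve-∀
  split : ∀ i → i ≤ n → (n C i) * ((i * f i) * g (n ∸ i)) + (n C i) * (f i * ((n ∸ i) * g (n ∸ i)))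
                       ≡ n * ((n C i) * (f i * g (n ∸ i)))
  split i i≤n = trans (collect (n C i) i (n ∸ i) (f i) (g (n ∸ i))) (cong (_* ((n C i) * (f i * g (n ∸ i)))) (m+[n∸m]≡n i≤n))

R : ∀ {k} → Vec ℕ k → ℕ → ℕ
R [] n = ind (n ≡ᵇ 0)
R (a ∷ t) = (λ m → stirling1 m a) ⋆ R t

R-zero : ∀ {k} (t : Vec ℕ k) → R t 0 ≡ ind (allZero t)
R-zero [] = refl
R-zero (a ∷ t) = begin
    stirling1 0 a * R t 0 + 0         ≡⟨ +-identityʳ _ ⟩
    stirling1 0 a * R t 0             ≡⟨ cong₂ _*_ (stirling1-zero a) (R-zero t) ⟩
    ind (0 ≡ᵇ a) * ind (allZero t)    ≡⟨ sym (ind-∧ (0 ≡ᵇ a) (allZero t)) ⟩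
    ind ((0 ≡ᵇ a) ∧ allZero t)        ≡⟨ cong ind (sym (allZero-∷ a t)) ⟩
    ind (allZero (a ∷ t))             ∎

-- R satisfies the recurrence of the coloured Stirling numbers: by the Leibniz rule, raising n
-- either raises the first factor (Stirling recurrence for colour 1) or the rest (induction).
R-suc : ∀ {k} (t : Vec ℕ k) n → R t (suc n) ≡ n * R t n + newCycleSum (λ t' → R t' n) t
R-suc [] zero = refl
R-suc [] (suc n) = sym (trans (+-identityʳ _) (*-zeroʳ (suc n)))
R-suc (a ∷ t) n = begin
    (f ⋆ g) (suc n)
  ≡⟨ ⋆-suc f g n ⟩
    ((f ∘ suc) ⋆ g) n + (f ⋆ (g ∘ suc)) n
  ≡⟨ cong₂ _+_ (trans (⋆-cong {f ∘ suc} {λ i → i * f i + z * f⁻ i} {g} (λ i → stirling1-suc i a) (λ _ → refl) n) (⋆-+ˡ (λ i → i * f i) (λ i → z * f⁻ i) g n))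
               (trans (⋆-cong {f} {f} {g ∘ suc} (λ _ → refl) (λ i → R-suc t i) n) (⋆-+ʳ f (λ m → m * g m) (λ m → newCycleSum (λ t' → R t' m) t) n)) ⟩
    (((λ i → i * f i) ⋆ g) n + ((λ i → z * f⁻ i) ⋆ g) n) + ((f ⋆ (λ m → m * g m)) n + (f ⋆ (λ m → newCycleSum (λ t' → R t' m) t)) n)
  ≡⟨ +-interchange (((λ i → i * f i) ⋆ g) n) _ _ _ ⟩
    (((λ i → i * f i) ⋆ g) n + (f ⋆ (λ m → m * g m)) n) + (((λ i → z * f⁻ i) ⋆ g) n + (f ⋆ (λ m → newCycleSum (λ t' → R t' m) t)) n)
  ≡⟨ cong₂ _+_ (⋆-weighted f g n) (cong₂ _+_ (⋆-*ˡ z f⁻ g n) otherColours) ⟩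
    n * (f ⋆ g) n + newCycleSum (λ t' → R t' n) (a ∷ t)
  ∎
  where
  f g f⁻ : ℕ → ℕ
  f m = stirling1 m a
  g = R t
  f⁻ m = stirling1 m (a ∸ 1)
  z : ℕ
  z = ind (not (a ≡ᵇ 0))
  +-interchange : ∀ a b c d → (a + b) + (c + d) ≡ (a + c) + (b + d)
  +-interchange = solve-∀
  otherColours : (f ⋆ (λ m → newCycleSum (λ t' → R t' m) t)) n
               ≡ Σl (λ j → ind (not (lookup (a ∷ t) j ≡ᵇ 0)) * R (lowerAt (a ∷ t) j) n) (Data.List.tabulate suc)
  otherColours = begin
      (f ⋆ (λ m → newCycleSum (λ t' → R t' m) t)) n
    ≡⟨ ⋆-Σʳ f (λ j m → ind (not (lookup t j ≡ᵇ 0)) * R (lowerAt t j) m) (allFin _) n ⟩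
      Σl (λ j → (f ⋆ (λ m → ind (not (lookup t j ≡ᵇ 0)) * R (lowerAt t j) m)) n) (allFin _)
    ≡⟨ Σl-cong (λ j → ⋆-*ʳ (ind (not (lookup t j ≡ᵇ 0))) f (R (lowerAt t j)) n) (allFin _) ⟩
      Σl (λ j → ind (not (lookup t j ≡ᵇ 0)) * (f ⋆ R (lowerAt t j)) n) (allFin _)
    ≡⟨ sym (Σl-tabulate (λ j → ind (not (lookup (a ∷ t) j ≡ᵇ 0)) * R (lowerAt (a ∷ t) j) n) suc) ⟩
      Σl (λ j → ind (not (lookup (a ∷ t) j ≡ᵇ 0)) * R (lowerAt (a ∷ t) j) n) (Data.List.tabulate suc)
    ∎

colouredStirling≡R : ∀ n {k} (t : Vec ℕ k) → colouredStirling n t ≡ R t n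
colouredStirling≡R zero t = trans (colouredStirling-zero t) (sym (R-zero t))
colouredStirling≡R (suc n) {k} t = begin
    colouredStirling (suc n) t
  ≡⟨ colouredStirling-suc n t ⟩
    n * colouredStirling n t + newCycleSum (colouredStirling n) t
  ≡⟨ cong₂ _+_ (cong (n *_) (colouredStirling≡R n t))
               (Σl-cong (λ j → cong (ind (not (lookup t j ≡ᵇ 0)) *_) (colouredStirling≡R n (lowerAt t j))) (allFin k)) ⟩
    n * R t n + newCycleSum (λ t' → R t' n) t
  ≡⟨ sym (R-suc t n) ⟩
    R t (suc n)
  ∎

-- Summing over ℓ ∈ [0, N]^k with ℓ₁ + ⋯ + ℓ_k = n and peeling off
-- ℓ₁ = a turns it into a binomial convolution, provided the multinomial coefficient is
-- written as the product of binomials C(ℓ₁ + ⋯ + ℓ_k, ℓ₁) C(ℓ₂ + ⋯ + ℓ_k, ℓ₂) ⋯.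

toℕs : ∀ {m k} → Vec (Fin m) k → Vec ℕ k
toℕs = Data.Vec.map toℕ

compositionSum : ℕ → (k : ℕ) → ℕ → (Vec ℕ k → ℕ) → ℕ
compositionSum N k n H = Σl (λ v → ind (vsum (toℕs v) ≡ᵇ n) * H (toℕs v)) (allVecs (suc N) k)

compositionSum-cong : ∀ N k n {H H' : Vec ℕ k → ℕ} → (∀ ℓ → vsum ℓ ≡ n → H ℓ ≡ H' ℓ) →
  compositionSum N k n H ≡ compositionSum N k n H'
compositionSum-cong N k n {H} {H'} e = Σl-cong agree (allVecs (suc N) k)
  where
  agree : ∀ v → ind (vsum (toℕs v) ≡ᵇ n) * H (toℕs v) ≡ ind (vsum (toℕs v) ≡ᵇ n) * H' (toℕs v)
  agree v with vsum (toℕs v) ≡ᵇ n in eq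
  ... | true = cong (1 *_) (e (toℕs v) (≡ᵇ-true eq))
  ... | false = refl

compositionSum-* : ∀ N k n c (H : Vec ℕ k → ℕ) → compositionSum N k n (λ ℓ → c * H ℓ) ≡ c * compositionSum N k n H
compositionSum-* N k n c H = trans (Σl-cong (λ v → swap (ind (vsum (toℕs v) ≡ᵇ n)) c (H (toℕs v))) (allVecs (suc N) k))
                                   (Σl-* c _ (allVecs (suc N) k))
  where
  swap : ∀ a c h → a * (c * h) ≡ c * (a * h)
  swap = solve-∀

ind-+≡ : ∀ a s n → ind (a + s ≡ᵇ n) ≡ ind (a ≤ᵇ n) * ind (s ≡ᵇ n ∸ a)
ind-+≡ a s n with a ≤? n
... | yes a≤n rewrite fromT (≤⇒≤ᵇ a≤n) = trans (cong ind (boolExt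
        (λ e → ≡ᵇ-intro (trans (sym (m+n∸m≡n a s)) (cong (_∸ a) (≡ᵇ-true e))))
        (λ e → ≡ᵇ-intro (trans (cong (a +_) (≡ᵇ-true e)) (m+[n∸m]≡n a≤n))))) (sym (+-identityʳ _))
... | no a≰n = trans (cong ind sum≢n) (cong (λ b → ind b * ind (s ≡ᵇ n ∸ a)) (sym a≰ᵇn))
  where
  sum≢n : (a + s ≡ᵇ n) ≡ false
  sum≢n with a + s ≡ᵇ n in e
  ... | true = ⊥-elim (a≰n (subst (a ≤_) (≡ᵇ-true e) (m≤m+n a s)))
  ... | false = refl
  a≰ᵇn : (a ≤ᵇ n) ≡ false
  a≰ᵇn with a ≤ᵇ n in e
  ... | true = ⊥-elim (a≰n (≤ᵇ⇒≤ a n (toT e)))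
  ... | false = refl

compositionSum-∷ : ∀ N k n (H : Vec ℕ (suc k) → ℕ) → n ≤ N →
  compositionSum N (suc k) n H ≡ sumTo n (λ a → compositionSum N k (n ∸ a) (λ ℓ → H (a ∷ ℓ)))
compositionSum-∷ N k n H n≤N = begin
    compositionSum N (suc k) n H
  ≡⟨ cong (Σl term) (allVecs-suc (suc N) k) ⟩
    Σl term (cartesianProductWith _∷_ (allFin (suc N)) (allVecs (suc N) k))
  ≡⟨ Σl-cartesian term _∷_ (allFin (suc N)) (allVecs (suc N) k) ⟩
    Σl (λ x → Σl (term ∘ (x ∷_)) (allVecs (suc N) k)) (allFin (suc N))
  ≡⟨ Σl-cong (λ x → first (toℕ x)) (allFin (suc N)) ⟩
    Σl (restricted ∘ toℕ) (allFin (suc N))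
  ≡⟨ Σl-allFin N restricted ⟩
    sumTo N restricted
  ≡⟨ cong (λ m → sumTo m restricted) (sym (m∸n+n≡m n≤N)) ⟩
    sumTo (N ∸ n + n) restricted
  ≡⟨ sumTo-vanishing n (N ∸ n) restricted (λ a n<a → cong (λ b → ind b * rest a) (a≰ᵇn a n<a)) ⟩
    sumTo n restricted
  ≡⟨ sumTo-cong n (λ a a≤n → trans (cong (λ b → ind b * rest a) (fromT (≤⇒≤ᵇ a≤n))) (+-identityʳ _)) ⟩
    sumTo n rest
  ∎
  where
  term : Vec (Fin (suc N)) (suc k) → ℕ
  term v = ind (vsum (toℕs v) ≡ᵇ n) * H (toℕs v)
  rest : ℕ → ℕ
  rest a = compositionSum N k (n ∸ a) (λ ℓ → H (a ∷ ℓ))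
  restricted : ℕ → ℕ
  restricted a = ind (a ≤ᵇ n) * rest a
  first : ∀ a → Σl (λ w → ind (a + vsum (toℕs w) ≡ᵇ n) * H (a ∷ toℕs w)) (allVecs (suc N) k) ≡ restricted a
  first a = trans (Σl-cong (λ w → trans (cong (_* H (a ∷ toℕs w)) (ind-+≡ a (vsum (toℕs w)) n))
                      (*-assoc (ind (a ≤ᵇ n)) _ _)) (allVecs (suc N) k))
                  (Σl-* (ind (a ≤ᵇ n)) _ (allVecs (suc N) k))
  a≰ᵇn : ∀ a → n < a → (a ≤ᵇ n) ≡ false
  a≰ᵇn a n<a with a ≤ᵇ n in e
  ... | true = ⊥-elim (<⇒≱ n<a (≤ᵇ⇒≤ a n (toT e)))
  ... | false = refl

binomialProduct : ∀ {k} → Vec ℕ k → ℕ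
binomialProduct [] = 1
binomialProduct (a ∷ ℓ) = ((a + vsum ℓ) C a) * binomialProduct ℓ

stirlingProduct : ∀ {k} → Vec ℕ k → Vec ℕ k → ℕ
stirlingProduct ℓ t = Data.Vec.foldr _ _*_ 1 (Data.Vec.zipWith stirling1 ℓ t)

binomial-factorials : ∀ a b → ((a + b) C a) * (a ! * b !) ≡ (a + b) !
binomial-factorials a b = subst (λ m → ((a + b) C a) * (a ! * m !) ≡ (a + b) !) (m+n∸m≡n a b)
  (trans (cong (_* (a ! * (a + b ∸ a) !)) (nCk≡n!/k![n-k]! (m≤m+n a b))) (m/n*n≡m {{m*n≢0 (a !) ((a + b ∸ a) !) {{a !≢0}} {{(a + b ∸ a) !≢0}}}} (k![n∸k]!∣n! (m≤m+n a b))))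

factorial-binomialProduct : ∀ {k} (ℓ : Vec ℕ k) → (vsum ℓ) ! ≡ binomialProduct ℓ * prodFact ℓ
factorial-binomialProduct [] = refl
factorial-binomialProduct (a ∷ ℓ) = begin
    (a + vsum ℓ) !
  ≡⟨ sym (binomial-factorials a (vsum ℓ)) ⟩
    ((a + vsum ℓ) C a) * (a ! * (vsum ℓ) !)
  ≡⟨ cong (λ z → ((a + vsum ℓ) C a) * (a ! * z)) (factorial-binomialProduct ℓ) ⟩
    ((a + vsum ℓ) C a) * (a ! * (binomialProduct ℓ * prodFact ℓ))
  ≡⟨ regroup ((a + vsum ℓ) C a) (a !) (binomialProduct ℓ) (prodFact ℓ) ⟩
    ((a + vsum ℓ) C a) * binomialProduct ℓ * (a ! * prodFact ℓ)
  ∎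
  where
  regroup : ∀ x y z w → x * (y * (z * w)) ≡ x * z * (y * w)
  regroup = solve-∀

multinomial≡binomialProduct : ∀ {k} n (ℓ : Vec ℕ k) → vsum ℓ ≡ n → multinomial n ℓ ≡ binomialProduct ℓ
multinomial≡binomialProduct n ℓ sum≡n = begin
    (n ! / prodFact ℓ) {{prodFact≢0 ℓ}}
  ≡⟨ cong (λ x → (x / prodFact ℓ) {{prodFact≢0 ℓ}}) (trans (cong _! (sym sum≡n)) (factorial-binomialProduct ℓ)) ⟩
    (binomialProduct ℓ * prodFact ℓ / prodFact ℓ) {{prodFact≢0 ℓ}}
  ≡⟨ m*n/n≡m (binomialProduct ℓ) (prodFact ℓ) {{prodFact≢0 ℓ}} ⟩
    binomialProduct ℓ
  ∎

compositionSum≡R : ∀ {k} (t : Vec ℕ k) n N → n ≤ N →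
  compositionSum N k n (λ ℓ → binomialProduct ℓ * stirlingProduct ℓ t) ≡ R t n
compositionSum≡R [] zero N _ = refl
compositionSum≡R [] (suc n) N _ = refl
compositionSum≡R {suc k} (b ∷ t) n N n≤N =
  trans (compositionSum-∷ N k n (λ ℓ → binomialProduct ℓ * stirlingProduct ℓ (b ∷ t)) n≤N) (sumTo-cong n term)
  where
  term : ∀ a → a ≤ n → compositionSum N k (n ∸ a) (λ ℓ → binomialProduct (a ∷ ℓ) * stirlingProduct (a ∷ ℓ) (b ∷ t))
                      ≡ (n C a) * (stirling1 a b * R t (n ∸ a))
  term a a≤n = begin
      compositionSum N k (n ∸ a) (λ ℓ → binomialProduct (a ∷ ℓ) * stirlingProduct (a ∷ ℓ) (b ∷ t))
    ≡⟨ compositionSum-cong N k (n ∸ a) factor ⟩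
      compositionSum N k (n ∸ a) (λ ℓ → ((n C a) * stirling1 a b) * (binomialProduct ℓ * stirlingProduct ℓ t))
    ≡⟨ compositionSum-* N k (n ∸ a) ((n C a) * stirling1 a b) (λ ℓ → binomialProduct ℓ * stirlingProduct ℓ t) ⟩
      ((n C a) * stirling1 a b) * compositionSum N k (n ∸ a) (λ ℓ → binomialProduct ℓ * stirlingProduct ℓ t)
    ≡⟨ cong (((n C a) * stirling1 a b) *_) (compositionSum≡R t (n ∸ a) N (≤-trans (m∸n≤m n a) n≤N)) ⟩
      ((n C a) * stirling1 a b) * R t (n ∸ a)
    ≡⟨ *-assoc (n C a) _ _ ⟩
      (n C a) * (stirling1 a b * R t (n ∸ a))
    ∎
    where
    regroup : ∀ x y s p → x * y * (s * p) ≡ x * s * (y * p)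
    regroup = solve-∀
    factor : ∀ ℓ → vsum ℓ ≡ n ∸ a → binomialProduct (a ∷ ℓ) * stirlingProduct (a ∷ ℓ) (b ∷ t)
                                  ≡ ((n C a) * stirling1 a b) * (binomialProduct ℓ * stirlingProduct ℓ t)
    factor ℓ sum≡n∸a = trans
      (cong (λ m → (m C a) * binomialProduct ℓ * (stirling1 a b * stirlingProduct ℓ t)) (trans (cong (a +_) sum≡n∸a) (m+[n∸m]≡n a≤n)))
      (regroup (n C a) (binomialProduct ℓ) (stirling1 a b) (stirlingProduct ℓ t))

rhs≡R : ∀ {k} n (t : Vec ℕ k) → rhs n t ≡ R t n
rhs≡R {k} n t = begin
    rhs n t
  ≡⟨ Σl-map term (Data.Vec.map toℕ) (filterᵇ (λ v → vsum (toℕs v) ≡ᵇ n) (allVecs (suc n) k)) ⟩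
    Σl (term ∘ toℕs) (filterᵇ (λ v → vsum (toℕs v) ≡ᵇ n) (allVecs (suc n) k))
  ≡⟨ Σl-filter (term ∘ toℕs) (λ v → vsum (toℕs v) ≡ᵇ n) (allVecs (suc n) k) ⟩
    compositionSum n k n term
  ≡⟨ compositionSum-cong n k n (λ ℓ sum≡n → cong (_* stirlingProduct ℓ t) (multinomial≡binomialProduct n ℓ sum≡n)) ⟩
    compositionSum n k n (λ ℓ → binomialProduct ℓ * stirlingProduct ℓ t)
  ≡⟨ compositionSum≡R t n n ≤-refl ⟩
    R t n
  ∎
  where
  term : Vec ℕ k → ℕ
  term ℓ = multinomial n ℓ * stirlingProduct ℓ t

-- Both sides equal R t n.
mainTheorem1 : (n k : ℕ) → 1 ≤ k → (t : Vec ℕ k) →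
    colouredStirling n t ≡ rhs n t
mainTheorem1 n k _ t = trans (colouredStirling≡R n t) (sym (rhs≡R n t))
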